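{- Let $G$ be the $dP_3$ lattice, fix a pair of opposite orientations $P$, and let $G'$ be the plane graph obtained from $G$ by applying urban renewal to every square whose orientation lies in $P$ and then double-edge contraction at every vertex of degree $2$. Let $M$ be a perfect matching of $G$, and define $M'$ as the set consisting of all edges of $M$ that survive in $G'$ (i.e. edges of $M$ lying neither on a $P$-square nor being the tail of a $P$-square), together with, for each $P$-kite $K$ (with vertices labelled $a,b,c,d,e$ as in the context), the following edges of $G'$: (i) if $M\cap E(K)=\{de\}$: either the two edges $a'b',c'd'$ or the two edges $a'd',b'c'$ (the choice being made arbitrarily and independently for each such kite); (ii) if $M\cap E(K)=\{ad\}$: the edge $b'c'$; if $M\cap E(K)=\{dc\}$: the edge $a'b'$; (iii) if $M\cap E(K)=\{de,bc\}$: the edges $a'd'$ and $bb'$; if $M\cap E(K)=\{de,ab\}$: the edges $c'd'$ and $bb'$; (iv) if $M\cap E(K)=\{ad,bc\}$ or $\{dc,ab\}$: the edge $bb'$. Then, for every choice made in case (i), $M'$ is a perfect matching of $G'$.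
   Context: The $dP_3$ lattice $G$: take the tiling of the plane by regular hexagons of side $1/\sqrt{3}$, oriented so that every hexagon has a vertex directly north of its center. Vertices of $G$: all hexagon centers, all hexagon vertices, all midpoints of hexagon sides. Edges of $G$: each hexagon center joined to the midpoints of the six sides of its hexagon, and each hexagon vertex joined to the midpoints of the three hexagon sides containing it. Every bounded face is a quadrilateral ("square") with vertices a center $b$, a hexagon vertex $d$ of the hexagon centered at $b$, and the midpoints $a,c$ of the two sides of that hexagon meeting at $d$; its boundary cycle is $a\,b\,c\,d$. The edges $ab,bc$ are its long edges and $ad,dc$ its short edges. The orientation of the square is the compass direction from $b$ to $d$ (one of $N,NE,SE,S,SW,NW$); pairs of opposite orientations are $\{N,S\},\{NE,SW\},\{NW,SE\}$. The vertex $d$ has degree $3$; its third edge $de$ (not on the square) is the tail of the square, and the square together with its tail is a kite $K$, with $E(K)=\{ab,bc,cd,da,de\}$. A $P$-square / $P$-kite is one whose orientation lies in $P$. Since every vertex of a perfect matching $M$ of $G$ is covered exactly once, $M\cap E(K)$ is always one of the seven sets $\{de\},\{ad\},\{dc\},\{de,bc\},\{de,ab\},\{ad,bc\},\{dc,ab\}$. Urban renewal at a $P$-square $abcd$: delete edges $ab,bc,cd,da$, add new vertices $a',b',c',d'$ inside the face and edges $aa',bb',cc',dd',a'b',b'c',c'd',d'a'$. After doing this at all $P$-squares, perform double-edge contraction at every vertex of degree $2$ (delete the vertex $v$, with neighbours $x\ne y$, and identify $x$ with $y$); the vertices of degree $2$ are exactly the vertices $a,c,d$ of the $P$-squares. Thus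 in $G'$ the edges $aa',cc',dd',de$ have disappeared, the edges $a'b',b'c',c'd',d'a',bb'$ are present, and every edge of $G$ that neither lies on a $P$-square nor is the tail of a $P$-square survives (with endpoints possibly identified). -}

module Defs where

open import Data.Integer using (ℤ; _+_; _-_; _*_; 1ℤ; +_)
open import Data.Product using (Σ; _×_; _,_; proj₁; proj₂)
open import Data.Sum using (_⊎_; inj₁; inj₂)
open import Data.Unit using (⊤)
open import Data.Empty using (⊥)
open import Data.List using (List; []; _∷_)
open import Data.List.Membership.Propositional using (_∈_)
open import Relation.Nullary using (¬_)
open import Relation.Binary.PropositionalEquality using (_≡_; refl; trans; cong)
open import Data.Integer.Properties using (+-assoc; +-inverseˡ; +-identityʳ)
import Data.Integer as ℤ
open import Relation.Binary.Construct.Closure.Equivalence using (EqClosure)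
open import Function.Bundles using (_⇔_)

-- Graphs (possibly with identified vertex representatives)
-- A graph is presented by a type of vertex representatives `Pt`, a
-- predicate `IsVertex` selecting those representatives that are
-- vertices, an identification `_≈_` of representatives (vertices are
-- the classes of representatives), a type of edges and the two ends of
-- each edge.

record Graph : Set₁ where
  field
    Pt       : Set
    IsVertex : Pt → Set
    _≈_      : Pt → Pt → Set
    Edge     : Set
    ends     : Edge → Pt × Pt

module _ (G : Graph) where
  open Graph G

  Covers : Edge → Pt → Set
  Covers e v = (proj₁ (ends e) ≈ v) ⊎ (proj₂ (ends e) ≈ v)

  IsPerfectMatching : (Edge → Set) → Set
  IsPerfectMatching M =
    (v : Pt) → IsVertex v →
      (Σ Edge λ e → M e × Covers e v) ×
      ((e₁ e₂ : Edge) → M e₁ → Covers e₁ v → M e₂ → Covers e₂ v → e₁ ≡ e₂)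

-- The dP3 lattice G
-- Let u = (1,0), w = (1/2, √3/2).  Hexagon centres are i·u + j·w
-- (i j : ℤ); hexagons have side 1/√3 and a vertex due north of their
-- centre.  We index all vertices by the cell (i , j) and a kind; their
-- positions, in units of u/6 and w/6, relative to 6·(i , j) are
--   ctr : (0,0)   hexagon centre
--   up  : (2,2)   hexagon vertex = centroid of centres (i,j),(i+1,j),(i,j+1)
--   dn  : (4,4)   hexagon vertex = centroid of (i+1,j),(i,j+1),(i+1,j+1)
--   m₁  : (3,0)   midpoint of the side between hexagons (i,j),(i+1,j)
--   m₂  : (0,3)   midpoint of the side between hexagons (i,j),(i,j+1)
--   m₃  : (3,3)   midpoint of the side between hexagons (i+1,j),(i,j+1)
-- (see `pos` below).

data V : Set where
  ctr up dn m₁ m₂ m₃ : ℤ → ℤ → V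

pos : V → ℤ × ℤ
pos (ctr i j) = (+ 6 * i , + 6 * j)
pos (up i j)  = (+ 6 * i + + 2 , + 6 * j + + 2)
pos (dn i j)  = (+ 6 * i + + 4 , + 6 * j + + 4)
pos (m₁ i j)  = (+ 6 * i + + 3 , + 6 * j)
pos (m₂ i j)  = (+ 6 * i , + 6 * j + + 3)
pos (m₃ i j)  = (+ 6 * i + + 3 , + 6 * j + + 3)

-- Every edge of G joins a midpoint to a centre or a hexagon vertex, so
-- an edge is named by its non-midpoint end and the direction (angle)
-- in which it leaves that end.
data CDir : Set where
  c0 c60 c120 c180 c240 c300 : CDir
data UDir : Set where
  uS uNW uNE : UDir
data DDir : Set where
  dN dSW dSE : DDir

cNb : ℤ → ℤ → CDir → V
cNb i j c0   = m₁ i j            -- displacement ( 3, 0)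
cNb i j c60  = m₂ i j            -- displacement ( 0, 3)
cNb i j c120 = m₃ (i - 1ℤ) j     -- displacement (-3, 3)
cNb i j c180 = m₁ (i - 1ℤ) j     -- displacement (-3, 0)
cNb i j c240 = m₂ i (j - 1ℤ)     -- displacement ( 0,-3)
cNb i j c300 = m₃ i (j - 1ℤ)     -- displacement ( 3,-3)

uNb : ℤ → ℤ → UDir → V
uNb i j uS  = m₁ i j             -- displacement ( 1,-2)
uNb i j uNW = m₂ i j             -- displacement (-2, 1)
uNb i j uNE = m₃ i j             -- displacement ( 1, 1)

dNb : ℤ → ℤ → DDir → V
dNb i j dSW = m₃ i j             -- displacement (-1,-1)
dNb i j dSE = m₂ (i + 1ℤ) j      -- displacement ( 2,-1)
dNb i j dN  = m₁ i (j + 1ℤ)      -- displacement (-1, 2)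

data EG : Set where
  ce : ℤ → ℤ → CDir → EG
  ue : ℤ → ℤ → UDir → EG
  de : ℤ → ℤ → DDir → EG

endsG : EG → V × V
endsG (ce i j k) = (ctr i j , cNb i j k)
endsG (ue i j k) = (up i j , uNb i j k)
endsG (de i j k) = (dn i j , dNb i j k)

dP3 : Graph
dP3 = record
  { Pt = V ; IsVertex = λ _ → ⊤ ; _≈_ = _≡_ ; Edge = EG ; ends = endsG }

data Orient : Set where
  N NE SE S SW NW : Orient

data OppPair : Set where
  NS NESW NWSE : OppPair

_∈ₚ_ : Orient → OppPair → Set
N  ∈ₚ NS   = ⊤
S  ∈ₚ NS   = ⊤
NE ∈ₚ NESW = ⊤
SW ∈ₚ NESW = ⊤
NW ∈ₚ NWSE = ⊤
SE ∈ₚ NWSE = ⊤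
_  ∈ₚ _    = ⊥

record Sq : Set where
  constructor sq
  field
    i j : ℤ
    o   : Orient

-- the vertices b, d (d lies in direction o from b), a, c (midpoints of
-- the two sides of the hexagon of b meeting at d; a is the one at angle
-- o - 30°, c the one at angle o + 30°, seen from b) and e (the other
-- end of the tail at d).
sqb : Sq → V
sqb (sq i j _) = ctr i j

sqd : Sq → V
sqd (sq i j NE) = up i j
sqd (sq i j N)  = dn (i - 1ℤ) j
sqd (sq i j NW) = up (i - 1ℤ) j
sqd (sq i j SW) = dn (i - 1ℤ) (j - 1ℤ)
sqd (sq i j S)  = up i (j - 1ℤ)
sqd (sq i j SE) = dn i (j - 1ℤ)

eab ebc ead edc etail : Sq → EG
eab (sq i j NE) = ce i j c0
eab (sq i j N)  = ce i j c60
eab (sq i j NW) = ce i j c120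
eab (sq i j SW) = ce i j c180
eab (sq i j S)  = ce i j c240
eab (sq i j SE) = ce i j c300

ebc (sq i j NE) = ce i j c60
ebc (sq i j N)  = ce i j c120
ebc (sq i j NW) = ce i j c180
ebc (sq i j SW) = ce i j c240
ebc (sq i j S)  = ce i j c300
ebc (sq i j SE) = ce i j c0

ead (sq i j NE) = ue i j uS
ead (sq i j N)  = de (i - 1ℤ) j dSE
ead (sq i j NW) = ue (i - 1ℤ) j uNE
ead (sq i j SW) = de (i - 1ℤ) (j - 1ℤ) dN
ead (sq i j S)  = ue i (j - 1ℤ) uNW
ead (sq i j SE) = de i (j - 1ℤ) dSW

edc (sq i j NE) = ue i j uNW
edc (sq i j N)  = de (i - 1ℤ) j dSW
edc (sq i j NW) = ue (i - 1ℤ) j uS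
edc (sq i j SW) = de (i - 1ℤ) (j - 1ℤ) dSE
edc (sq i j S)  = ue i (j - 1ℤ) uNE
edc (sq i j SE) = de i (j - 1ℤ) dN

etail (sq i j NE) = ue i j uNE
etail (sq i j N)  = de (i - 1ℤ) j dN
etail (sq i j NW) = ue (i - 1ℤ) j uNW
etail (sq i j SW) = de (i - 1ℤ) (j - 1ℤ) dSW
etail (sq i j S)  = ue i (j - 1ℤ) uS
etail (sq i j SE) = de i (j - 1ℤ) dSE

sqa sqc sqe : Sq → V
sqa s = proj₂ (endsG (eab s))
sqc s = proj₂ (endsG (ebc s))
sqe s = proj₂ (endsG (etail s))

i-1+1 : ∀ i → i - 1ℤ + 1ℤ ≡ i
i-1+1 i = trans (+-assoc i (ℤ.- 1ℤ) 1ℤ) (trans (cong (λ k → i + k) (+-inverseˡ 1ℤ)) (+-identityʳ i))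

ead-ends : ∀ s → endsG (ead s) ≡ (sqd s , sqa s)
ead-ends (sq i j N)  = cong (λ k → (dn (i - 1ℤ) j , m₂ k j)) (i-1+1 i)
ead-ends (sq i j NE) = refl
ead-ends (sq i j SE) = refl
ead-ends (sq i j S)  = refl
ead-ends (sq i j SW) = cong (λ k → (dn (i - 1ℤ) (j - 1ℤ) , m₁ (i - 1ℤ) k)) (i-1+1 j)
ead-ends (sq i j NW) = refl

edc-ends : ∀ s → endsG (edc s) ≡ (sqd s , sqc s)
edc-ends (sq i j N)  = refl
edc-ends (sq i j NE) = refl
edc-ends (sq i j SE) = cong (λ k → (dn i (j - 1ℤ) , m₁ i k)) (i-1+1 j)
edc-ends (sq i j S)  = refl
edc-ends (sq i j SW) = cong (λ k → (dn (i - 1ℤ) (j - 1ℤ) , m₂ k (j - 1ℤ))) (i-1+1 i)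
edc-ends (sq i j NW) = refl

etail-ends : ∀ s → proj₁ (endsG (etail s)) ≡ sqd s
etail-ends (sq i j N)  = refl
etail-ends (sq i j NE) = refl
etail-ends (sq i j SE) = refl
etail-ends (sq i j S)  = refl
etail-ends (sq i j SW) = refl
etail-ends (sq i j NW) = refl

sqEdges kiteEdges : Sq → List EG
sqEdges s = eab s ∷ ebc s ∷ edc s ∷ ead s ∷ []
kiteEdges s = eab s ∷ ebc s ∷ edc s ∷ ead s ∷ etail s ∷ []

module _ (P : OppPair) where

  PSq : Set
  PSq = Σ Sq λ s → Sq.o s ∈ₚ P

  data Corner : Set where
    a′ b′ c′ d′ : Corner

  VH : Set
  VH = V ⊎ (PSq × Corner)

  -- old edges lying on some P-square (deleted by urban renewal)
  OnPSq : EG → Set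
  OnPSq e = Σ PSq λ s → e ∈ sqEdges (proj₁ s)

  OnPKite : EG → Set
  OnPKite e = Σ PSq λ s → e ∈ kiteEdges (proj₁ s)

  record EGnotOnPSq : Set where
    constructor keepH
    field
      edge : EG
      .notOn : ¬ OnPSq edge

  data NewH : Set where
    aa′ bb′ cc′ dd′ a′b′ b′c′ c′d′ d′a′ : NewH

  EH : Set
  EH = EGnotOnPSq ⊎ (PSq × NewH)

  old : V → VH
  old = inj₁

  new : PSq → Corner → VH
  new s x = inj₂ (s , x)

  endsH : EH → VH × VH
  endsH (inj₁ e) = (old (proj₁ (endsG (EGnotOnPSq.edge e))) ,
                    old (proj₂ (endsG (EGnotOnPSq.edge e))))
  endsH (inj₂ (s , aa′)) = (old (sqa (proj₁ s)) , new s a′)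
  endsH (inj₂ (s , bb′)) = (old (sqb (proj₁ s)) , new s b′)
  endsH (inj₂ (s , cc′)) = (old (sqc (proj₁ s)) , new s c′)
  endsH (inj₂ (s , dd′)) = (old (sqd (proj₁ s)) , new s d′)
  endsH (inj₂ (s , a′b′)) = (new s a′ , new s b′)
  endsH (inj₂ (s , b′c′)) = (new s b′ , new s c′)
  endsH (inj₂ (s , c′d′)) = (new s c′ , new s d′)
  endsH (inj₂ (s , d′a′)) = (new s d′ , new s a′)

  AdjH : VH → VH → Set
  AdjH x y = Σ EH λ e → (endsH e ≡ (x , y)) ⊎ (endsH e ≡ (y , x))

  -- Double-edge contraction at every degree-2 vertex of H, i.e. at the
  -- vertices a, c, d of the P-squares: the vertex is deleted and its two
  -- neighbours are identified.

  Contracted : VH → Set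
  Contracted v = Σ PSq λ s →
    (v ≡ old (sqa (proj₁ s))) ⊎ (v ≡ old (sqc (proj₁ s))) ⊎ (v ≡ old (sqd (proj₁ s)))

  Ident : VH → VH → Set
  Ident x y = Σ VH λ v → Contracted v × AdjH v x × AdjH v y

  -- edges of G': old edges neither on a P-square nor a tail of one, and
  -- the new edges a'b', b'c', c'd', d'a', bb' (aa', cc', dd' and the
  -- tails disappear in the contractions)
  record EGsurv : Set where
    constructor keep
    field
      edge : EG
      .notOn : ¬ OnPKite edge

  data NewG′ : Set where
    bb′ a′b′ b′c′ c′d′ d′a′ : NewG′

  E′ : Set
  E′ = EGsurv ⊎ (PSq × NewG′)

  ends′ : E′ → VH × VH
  ends′ (inj₁ e) = (old (proj₁ (endsG (EGsurv.edge e))) ,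
                    old (proj₂ (endsG (EGsurv.edge e))))
  ends′ (inj₂ (s , bb′))  = (old (sqb (proj₁ s)) , new s b′)
  ends′ (inj₂ (s , a′b′)) = (new s a′ , new s b′)
  ends′ (inj₂ (s , b′c′)) = (new s b′ , new s c′)
  ends′ (inj₂ (s , c′d′)) = (new s c′ , new s d′)
  ends′ (inj₂ (s , d′a′)) = (new s d′ , new s a′)

  G′ : Graph
  G′ = record
    { Pt = VH
    ; IsVertex = λ v → ¬ Contracted v
    ; _≈_ = EqClosure Ident
    ; Edge = E′
    ; ends = ends′
    }

  MeetsAs : (EG → Set) → Sq → List EG → Set
  MeetsAs M s X = (e : EG) → e ∈ kiteEdges s → (M e ⇔ (e ∈ X))

  data Choice : Set where
    ab∣cd ad∣bc : Choice

  M′ : (EG → Set) → (PSq → Choice) → E′ → Set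
  M′ M ch (inj₁ e) = M (EGsurv.edge e)
  M′ M ch (inj₂ (s , a′b′)) =
      (MeetsAs M (proj₁ s) (etail (proj₁ s) ∷ []) × ch s ≡ ab∣cd)
    ⊎ MeetsAs M (proj₁ s) (edc (proj₁ s) ∷ [])
  M′ M ch (inj₂ (s , c′d′)) =
      (MeetsAs M (proj₁ s) (etail (proj₁ s) ∷ []) × ch s ≡ ab∣cd)
    ⊎ MeetsAs M (proj₁ s) (etail (proj₁ s) ∷ eab (proj₁ s) ∷ [])
  M′ M ch (inj₂ (s , d′a′)) =
      (MeetsAs M (proj₁ s) (etail (proj₁ s) ∷ []) × ch s ≡ ad∣bc)
    ⊎ MeetsAs M (proj₁ s) (etail (proj₁ s) ∷ ebc (proj₁ s) ∷ [])
  M′ M ch (inj₂ (s , b′c′)) =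
      (MeetsAs M (proj₁ s) (etail (proj₁ s) ∷ []) × ch s ≡ ad∣bc)
    ⊎ MeetsAs M (proj₁ s) (ead (proj₁ s) ∷ [])
  M′ M ch (inj₂ (s , bb′)) =
      MeetsAs M (proj₁ s) (etail (proj₁ s) ∷ ebc (proj₁ s) ∷ [])
    ⊎ MeetsAs M (proj₁ s) (etail (proj₁ s) ∷ eab (proj₁ s) ∷ [])
    ⊎ MeetsAs M (proj₁ s) (ead (proj₁ s) ∷ ebc (proj₁ s) ∷ [])
    ⊎ MeetsAs M (proj₁ s) (edc (proj₁ s) ∷ eab (proj₁ s) ∷ [])

-- A vertex of G′ is a class of vertices of H; sending a′ to a, c′ to c and d′ to the far end e of the tail
-- at d picks a representative (classOf) that is invariant under the contractions. M meets every P-kite in one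
-- of seven patterns, and for each pattern the prescribed new edges always match b′, and match a′, c′, d′
-- exactly when a, c, d are not matched inside the kite (for d: when its tail is). Every edge of G survives or
-- lies on exactly one P-kite. A contracted midpoint is a vertex of exactly two P-squares and M matches it
-- inside exactly one of them, so exactly one of the two identified corners is matched. A centre or a tail end
-- keeps its matching edge of M, except that a long edge of a P-kite is replaced by bb′ and a tail by the
-- renewed edge at d′.

module Submission where

open import Defs
open import Data.Bool using (Bool; true; false; T)
open import Data.Empty using (⊥; ⊥-elim)
import Data.Empty.Irrelevant as Irrelevant
open import Data.Integer using (ℤ; _+_; _-_; 1ℤ)
import Data.Integer as ℤ
import Data.Integer.Properties as ℤₚ
open import Data.List using (List; []; _∷_; map; filterᵇ)
open import Data.List.Membership.Propositional using (_∈_)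
open import Data.List.Membership.Propositional.Properties using (∈-map⁺; ∈-map⁻; ∈-filter⁺; ∈-filter⁻)
open import Data.List.Relation.Unary.Any using (here; there)
open import Data.Maybe using (Maybe; just; nothing)
open import Data.Maybe.Properties using (just-injective)
open import Data.Nat using (ℕ)
import Data.Nat as ℕ
open import Data.Product using (Σ; ∃; _×_; _,_; proj₁; proj₂; uncurry)
import Data.Product.Properties as Product
open import Data.Sum using (_⊎_; inj₁; inj₂)
open import Data.Sum.Properties using (inj₁-injective)
open import Data.Unit using (⊤; tt)
open import Function using (_∘_)
open import Function.Bundles using (_⇔_; mk⇔; Equivalence)
open import Relation.Binary.Definitions using (DecidableEquality; Reflexive)
open import Relation.Binary.PropositionalEquality
  using (_≡_; _≢_; refl; sym; trans; cong; cong₂; subst; isEquivalence; module ≡-Reasoning)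
open import Relation.Binary.Construct.Closure.Equivalence using (EqClosure; gfold)
open import Relation.Binary.Construct.Closure.ReflexiveTransitive using (ε; _◅_; _◅◅_)
open import Relation.Binary.Construct.Closure.Symmetric using (fwd; bwd)
open import Relation.Nullary using (¬_; Dec; yes; no)
open import Relation.Nullary.Decidable using (map′; does-⇔; T?)
import Function.Properties.Equivalence as ⇔
open import Relation.Unary using (Decidable)

module PerfectMatching {G : Graph} {M : Graph.Edge G → Set} (pm : IsPerfectMatching G M) where
  open Graph G

  mate : ∀ v → IsVertex v → Edge
  mate v v∈ = proj₁ (proj₁ (pm v v∈))

  mate∈M : ∀ v v∈ → M (mate v v∈)
  mate∈M v v∈ = proj₁ (proj₂ (proj₁ (pm v v∈)))

  mate-covers : ∀ v v∈ → Covers G (mate v v∈) v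
  mate-covers v v∈ = proj₂ (proj₂ (proj₁ (pm v v∈)))

  unique : ∀ {v} → IsVertex v → ∀ {e e′} → M e → Covers G e v → M e′ → Covers G e′ v → e ≡ e′
  unique v∈ m cov m′ cov′ = proj₂ (pm _ v∈) _ _ m cov m′ cov′

  decidable : DecidableEquality Edge → (∀ e → IsVertex (proj₁ (ends e))) → Reflexive _≈_ →
              Decidable M
  decidable _≟_ src∈ ≈-refl e =
    map′ (λ eq → subst M eq (mate∈M _ (src∈ e)))
         (λ m → unique (src∈ e) (mate∈M _ (src∈ e)) (mate-covers _ (src∈ e)) m (inj₁ ≈-refl))
         (mate _ (src∈ e) ≟ e)

src tgt : EG → V
src e = proj₁ (endsG e)
tgt e = proj₂ (endsG e)

IsCentre IsMidpoint : V → Set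
IsCentre (ctr _ _) = ⊤
IsCentre _         = ⊥
IsMidpoint (m₁ _ _) = ⊤
IsMidpoint (m₂ _ _) = ⊤
IsMidpoint (m₃ _ _) = ⊤
IsMidpoint _        = ⊥

tgt-midpoint : ∀ e → IsMidpoint (tgt e)
tgt-midpoint (ce _ _ c0)   = tt
tgt-midpoint (ce _ _ c60)  = tt
tgt-midpoint (ce _ _ c120) = tt
tgt-midpoint (ce _ _ c180) = tt
tgt-midpoint (ce _ _ c240) = tt
tgt-midpoint (ce _ _ c300) = tt
tgt-midpoint (ue _ _ uS)   = tt
tgt-midpoint (ue _ _ uNW)  = tt
tgt-midpoint (ue _ _ uNE)  = tt
tgt-midpoint (de _ _ dN)   = tt
tgt-midpoint (de _ _ dSW)  = tt
tgt-midpoint (de _ _ dSE)  = tt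

src-not-midpoint : ∀ e → ¬ IsMidpoint (src e)
src-not-midpoint (ce _ _ _) ()
src-not-midpoint (ue _ _ _) ()
src-not-midpoint (de _ _ _) ()

covers-midpoint : ∀ {v} e → IsMidpoint v → Covers dP3 e v → tgt e ≡ v
covers-midpoint e mid (inj₁ eq) = ⊥-elim (src-not-midpoint e (subst IsMidpoint (sym eq) mid))
covers-midpoint e mid (inj₂ eq) = eq

covers-non-midpoint : ∀ {v} e → ¬ IsMidpoint v → Covers dP3 e v → src e ≡ v
covers-non-midpoint e ¬mid (inj₁ eq) = eq
covers-non-midpoint e ¬mid (inj₂ eq) = ⊥-elim (¬mid (subst IsMidpoint eq (tgt-midpoint e)))

+1-1 : ∀ i → i + 1ℤ - 1ℤ ≡ i
+1-1 i = trans (ℤₚ.+-assoc i 1ℤ (ℤ.- 1ℤ)) (trans (cong (i +_) (ℤₚ.+-inverseʳ 1ℤ)) (ℤₚ.+-identityʳ i))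

-1-injective : ∀ {i j} → i - 1ℤ ≡ j - 1ℤ → i ≡ j
-1-injective {i} {j} eq = trans (sym (i-1+1 i)) (trans (cong (_+ 1ℤ) eq) (i-1+1 j))

direction : EG → ℕ
direction (ce _ _ c0)   = 0
direction (ce _ _ c60)  = 1
direction (ce _ _ c120) = 2
direction (ce _ _ c180) = 3
direction (ce _ _ c240) = 4
direction (ce _ _ c300) = 5
direction (ue _ _ uS)   = 6
direction (ue _ _ uNW)  = 7
direction (ue _ _ uNE)  = 8
direction (de _ _ dN)   = 9
direction (de _ _ dSW)  = 10
direction (de _ _ dSE)  = 11

cell : EG → ℤ × ℤ
cell (ce i j _) = i , j
cell (ue i j _) = i , j
cell (de i j _) = i , j

edgeAt : ℕ → ℤ × ℤ → EG
edgeAt 0  (i , j) = ce i j c0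
edgeAt 1  (i , j) = ce i j c60
edgeAt 2  (i , j) = ce i j c120
edgeAt 3  (i , j) = ce i j c180
edgeAt 4  (i , j) = ce i j c240
edgeAt 5  (i , j) = ce i j c300
edgeAt 6  (i , j) = ue i j uS
edgeAt 7  (i , j) = ue i j uNW
edgeAt 8  (i , j) = ue i j uNE
edgeAt 9  (i , j) = de i j dN
edgeAt 10 (i , j) = de i j dSW
edgeAt _  (i , j) = de i j dSE

edgeAt-code : ∀ e → edgeAt (direction e) (cell e) ≡ e
edgeAt-code (ce _ _ c0)   = refl
edgeAt-code (ce _ _ c60)  = refl
edgeAt-code (ce _ _ c120) = refl
edgeAt-code (ce _ _ c180) = refl
edgeAt-code (ce _ _ c240) = refl
edgeAt-code (ce _ _ c300) = refl
edgeAt-code (ue _ _ uS)   = refl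
edgeAt-code (ue _ _ uNW)  = refl
edgeAt-code (ue _ _ uNE)  = refl
edgeAt-code (de _ _ dN)   = refl
edgeAt-code (de _ _ dSW)  = refl
edgeAt-code (de _ _ dSE)  = refl

_≟ᴱ_ : DecidableEquality EG
e ≟ᴱ e′ = map′ code-injective (cong code) (code e ≟ code e′)
  where
  code : EG → ℕ × ℤ × ℤ
  code e = direction e , cell e
  _≟_ : DecidableEquality (ℕ × ℤ × ℤ)
  _≟_ = Product.≡-dec ℕ._≟_ (Product.≡-dec ℤ._≟_ ℤ._≟_)
  code-injective : ∀ {e e′} → code e ≡ code e′ → e ≡ e′
  code-injective {e} {e′} eq =
    trans (sym (edgeAt-code e)) (trans (cong (uncurry edgeAt) eq) (edgeAt-code e′))

-- Kites and their states

data KiteEdge : Set where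
  ab bc dc ad tail : KiteEdge

kiteEdge : Sq → KiteEdge → EG
kiteEdge s ab   = eab s
kiteEdge s bc   = ebc s
kiteEdge s dc   = edc s
kiteEdge s ad   = ead s
kiteEdge s tail = etail s

kindIn : Orient → EG → KiteEdge
kindIn N  = λ { (ce _ _ c60)  → ab ; (ce _ _ c120) → bc ; (de _ _ dSW) → dc ; (de _ _ dSE) → ad ; _ → tail }
kindIn NE = λ { (ce _ _ c0)   → ab ; (ce _ _ c60)  → bc ; (ue _ _ uNW) → dc ; (ue _ _ uS)  → ad ; _ → tail }
kindIn SE = λ { (ce _ _ c300) → ab ; (ce _ _ c0)   → bc ; (de _ _ dN)  → dc ; (de _ _ dSW) → ad ; _ → tail }
kindIn S  = λ { (ce _ _ c240) → ab ; (ce _ _ c300) → bc ; (ue _ _ uNE) → dc ; (ue _ _ uNW) → ad ; _ → tail }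
kindIn SW = λ { (ce _ _ c180) → ab ; (ce _ _ c240) → bc ; (de _ _ dSE) → dc ; (de _ _ dN)  → ad ; _ → tail }
kindIn NW = λ { (ce _ _ c120) → ab ; (ce _ _ c180) → bc ; (ue _ _ uS)  → dc ; (ue _ _ uNE) → ad ; _ → tail }

kindIn-kiteEdge : ∀ s k → kindIn (Sq.o s) (kiteEdge s k) ≡ k
kindIn-kiteEdge (sq _ _ N)  = λ { ab → refl ; bc → refl ; dc → refl ; ad → refl ; tail → refl }
kindIn-kiteEdge (sq _ _ NE) = λ { ab → refl ; bc → refl ; dc → refl ; ad → refl ; tail → refl }
kindIn-kiteEdge (sq _ _ SE) = λ { ab → refl ; bc → refl ; dc → refl ; ad → refl ; tail → refl }
kindIn-kiteEdge (sq _ _ S)  = λ { ab → refl ; bc → refl ; dc → refl ; ad → refl ; tail → refl }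
kindIn-kiteEdge (sq _ _ SW) = λ { ab → refl ; bc → refl ; dc → refl ; ad → refl ; tail → refl }
kindIn-kiteEdge (sq _ _ NW) = λ { ab → refl ; bc → refl ; dc → refl ; ad → refl ; tail → refl }

kiteEdge-injective : ∀ s {k k′} → kiteEdge s k ≡ kiteEdge s k′ → k ≡ k′
kiteEdge-injective s {k} {k′} eq =
  trans (sym (kindIn-kiteEdge s k)) (trans (cong (kindIn (Sq.o s)) eq) (kindIn-kiteEdge s k′))

∈kiteEdges : ∀ {s e} → e ∈ kiteEdges s → ∃ λ k → kiteEdge s k ≡ e
∈kiteEdges (here eq)                                 = ab   , sym eq
∈kiteEdges (there (here eq))                         = bc   , sym eq
∈kiteEdges (there (there (here eq)))                 = dc   , sym eq
∈kiteEdges (there (there (there (here eq))))         = ad   , sym eq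
∈kiteEdges (there (there (there (there (here eq))))) = tail , sym eq

kiteEdge∈kiteEdges : ∀ s k → kiteEdge s k ∈ kiteEdges s
kiteEdge∈kiteEdges s ab   = here refl
kiteEdge∈kiteEdges s bc   = there (here refl)
kiteEdge∈kiteEdges s dc   = there (there (here refl))
kiteEdge∈kiteEdges s ad   = there (there (there (here refl)))
kiteEdge∈kiteEdges s tail = there (there (there (there (here refl))))

ab∋a : ∀ s → Covers dP3 (eab s) (sqa s)
ab∋a s = inj₂ refl

ad∋a : ∀ s → Covers dP3 (ead s) (sqa s)
ad∋a s = inj₂ (cong proj₂ (ead-ends s))

bc∋c : ∀ s → Covers dP3 (ebc s) (sqc s)
bc∋c s = inj₂ refl

dc∋c : ∀ s → Covers dP3 (edc s) (sqc s)
dc∋c s = inj₂ (cong proj₂ (edc-ends s))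

ad∋d : ∀ s → Covers dP3 (ead s) (sqd s)
ad∋d s = inj₁ (cong proj₁ (ead-ends s))

dc∋d : ∀ s → Covers dP3 (edc s) (sqd s)
dc∋d s = inj₁ (cong proj₁ (edc-ends s))

tail∋d : ∀ s → Covers dP3 (etail s) (sqd s)
tail∋d s = inj₁ (etail-ends s)

src-long : ∀ s → src (eab s) ≡ sqb s × src (ebc s) ≡ sqb s
src-long (sq _ _ N)  = refl , refl
src-long (sq _ _ NE) = refl , refl
src-long (sq _ _ SE) = refl , refl
src-long (sq _ _ S)  = refl , refl
src-long (sq _ _ SW) = refl , refl
src-long (sq _ _ NW) = refl , refl

ab∋b : ∀ s → Covers dP3 (eab s) (sqb s)
ab∋b s = inj₁ (proj₁ (src-long s))

bc∋b : ∀ s → Covers dP3 (ebc s) (sqb s)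
bc∋b s = inj₁ (proj₂ (src-long s))

star-up : ∀ {i j} e → src e ≡ up i j → ∃ λ k → e ≡ ue i j k
star-up (ue _ _ k) refl = k , refl
star-up (ce _ _ _) ()
star-up (de _ _ _) ()

star-dn : ∀ {i j} e → src e ≡ dn i j → ∃ λ k → e ≡ de i j k
star-dn (de _ _ k) refl = k , refl
star-dn (ce _ _ _) ()
star-dn (ue _ _ _) ()

star-d : ∀ s {e} → Covers dP3 e (sqd s) → e ≡ ead s ⊎ e ≡ edc s ⊎ e ≡ etail s
star-d (sq _ _ N) {e} cov with star-dn e (covers-non-midpoint e (λ ()) cov)
... | dSE , refl = inj₁ refl
... | dSW , refl = inj₂ (inj₁ refl)
... | dN  , refl = inj₂ (inj₂ refl)
star-d (sq _ _ NE) {e} cov with star-up e (covers-non-midpoint e (λ ()) cov)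
... | uS  , refl = inj₁ refl
... | uNW , refl = inj₂ (inj₁ refl)
... | uNE , refl = inj₂ (inj₂ refl)
star-d (sq _ _ SE) {e} cov with star-dn e (covers-non-midpoint e (λ ()) cov)
... | dSW , refl = inj₁ refl
... | dN  , refl = inj₂ (inj₁ refl)
... | dSE , refl = inj₂ (inj₂ refl)
star-d (sq _ _ S) {e} cov with star-up e (covers-non-midpoint e (λ ()) cov)
... | uNW , refl = inj₁ refl
... | uNE , refl = inj₂ (inj₁ refl)
... | uS  , refl = inj₂ (inj₂ refl)
star-d (sq _ _ SW) {e} cov with star-dn e (covers-non-midpoint e (λ ()) cov)
... | dN  , refl = inj₁ refl
... | dSE , refl = inj₂ (inj₁ refl)
... | dSW , refl = inj₂ (inj₂ refl)
star-d (sq _ _ NW) {e} cov with star-up e (covers-non-midpoint e (λ ()) cov)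
... | uNE , refl = inj₁ refl
... | uS  , refl = inj₂ (inj₁ refl)
... | uNW , refl = inj₂ (inj₂ refl)

-- The seven possible values of M ∩ E(K)
data KiteState : Set where
  DE AD DC DEBC DEAB ADBC DCAB : KiteState

_∈ᵏ_ : KiteEdge → KiteState → Bool
tail ∈ᵏ DE   = true
ad   ∈ᵏ AD   = true
dc   ∈ᵏ DC   = true
tail ∈ᵏ DEBC = true
bc   ∈ᵏ DEBC = true
tail ∈ᵏ DEAB = true
ab   ∈ᵏ DEAB = true
ad   ∈ᵏ ADBC = true
bc   ∈ᵏ ADBC = true
dc   ∈ᵏ DCAB = true
ab   ∈ᵏ DCAB = true
_    ∈ᵏ _    = false

-- In this order, map (kiteEdge s) (edgesIn st) is literally the list used for st in the definition of M′.
allKiteEdges : List KiteEdge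
allKiteEdges = tail ∷ ad ∷ dc ∷ ab ∷ bc ∷ []

edgesIn : KiteState → List KiteEdge
edgesIn st = filterᵇ (_∈ᵏ st) allKiteEdges

∈-edgesIn : ∀ {k st} → k ∈ edgesIn st ⇔ T (k ∈ᵏ st)
∈-edgesIn {k} {st} =
  mk⇔ (proj₂ ∘ ∈-filter⁻ (T? ∘ (_∈ᵏ st)) {xs = allKiteEdges}) (∈-filter⁺ (T? ∘ (_∈ᵏ st)) (listed k))
  where
  listed : ∀ k → k ∈ allKiteEdges
  listed tail = here refl
  listed ad   = there (here refl)
  listed dc   = there (there (here refl))
  listed ab   = there (there (there (here refl)))
  listed bc   = there (there (there (there (here refl))))

profile : KiteState → Bool × Bool × Bool × Bool × Bool
profile st = tail ∈ᵏ st , ad ∈ᵏ st , dc ∈ᵏ st , ab ∈ᵏ st , bc ∈ᵏ st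

fromProfile : Bool × Bool × Bool × Bool × Bool → KiteState
fromProfile (true  , false , false , false , true ) = DEBC
fromProfile (true  , false , false , true  , false) = DEAB
fromProfile (false , true  , false , false , false) = AD
fromProfile (false , true  , false , false , true ) = ADBC
fromProfile (false , false , true  , false , false) = DC
fromProfile (false , false , true  , true  , false) = DCAB
fromProfile _                                       = DE

fromProfile-profile : ∀ st → fromProfile (profile st) ≡ st
fromProfile-profile DE   = refl
fromProfile-profile AD   = refl
fromProfile-profile DC   = refl
fromProfile-profile DEBC = refl
fromProfile-profile DEAB = refl
fromProfile-profile ADBC = refl
fromProfile-profile DCAB = refl

∈ᵏ-injective : ∀ {st st′} → (∀ k → T (k ∈ᵏ st) ⇔ T (k ∈ᵏ st′)) → st ≡ st′
∈ᵏ-injective {st} {st′} same = begin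
  st                        ≡⟨ sym (fromProfile-profile st) ⟩
  fromProfile (profile st)  ≡⟨ cong fromProfile same-profile ⟩
  fromProfile (profile st′) ≡⟨ fromProfile-profile st′ ⟩
  st′                       ∎
  where
  open ≡-Reasoning
  at : ∀ k → k ∈ᵏ st ≡ k ∈ᵏ st′
  at k = does-⇔ (same k) (T? _) (T? _)
  same-profile : profile st ≡ profile st′
  same-profile = cong₂ _,_ (at tail) (cong₂ _,_ (at ad) (cong₂ _,_ (at dc) (cong₂ _,_ (at ab) (at bc))))

module _ (P : OppPair) (M : EG → Set) where

  Meets : Sq → KiteState → Set
  Meets s st = MeetsAs P M s (map (kiteEdge s) (edgesIn st))

  meets⇔ : ∀ {s st} → Meets s st ⇔ (∀ k → M (kiteEdge s k) ⇔ T (k ∈ᵏ st))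
  meets⇔ {s} {st} = mk⇔ (λ h k → ⇔.trans (h _ (kiteEdge∈kiteEdges s k)) listed)
                        (λ h e e∈ → reassemble h (∈kiteEdges e∈))
    where
    listed : ∀ {k} → kiteEdge s k ∈ map (kiteEdge s) (edgesIn st) ⇔ T (k ∈ᵏ st)
    listed {k} = ⇔.trans (mk⇔ to (∈-map⁺ (kiteEdge s))) ∈-edgesIn
      where
      to : kiteEdge s k ∈ map (kiteEdge s) (edgesIn st) → k ∈ edgesIn st
      to k∈ with ∈-map⁻ (kiteEdge s) k∈
      ... | k′ , k′∈ , eq = subst (_∈ edgesIn st) (sym (kiteEdge-injective s eq)) k′∈
    reassemble : (∀ k → M (kiteEdge s k) ⇔ T (k ∈ᵏ st)) → ∀ {e} → (∃ λ k → kiteEdge s k ≡ e) →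
                 M e ⇔ (e ∈ map (kiteEdge s) (edgesIn st))
    reassemble h (k , refl) = ⇔.trans (h k) (⇔.sym listed)

  meets-unique : ∀ {s st st′} → Meets s st → Meets s st′ → st ≡ st′
  meets-unique m m′ = ∈ᵏ-injective λ k →
    ⇔.trans (⇔.sym (Equivalence.to meets⇔ m k)) (Equivalence.to meets⇔ m′ k)

Status : Bool → Set → Set
Status true  A = A
Status false A = ¬ A

module KiteStates {M : EG → Set} (pm : IsPerfectMatching dP3 M) (P : OppPair) where
  open PerfectMatching {G = dP3} pm

  M? : Decidable M
  M? = decidable _≟ᴱ_ (λ _ → tt) refl

  stateBy : ∀ {s} st → (∀ k → Status (k ∈ᵏ st) (M (kiteEdge s k))) → Σ KiteState (Meets P M s)
  stateBy st h = st , Equivalence.from (meets⇔ P M) λ k → status⇔ (h k)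
    where
    status⇔ : ∀ {b A} → Status b A → A ⇔ T b
    status⇔ {true}  a  = mk⇔ (λ _ → tt) (λ _ → a)
    status⇔ {false} ¬a = mk⇔ ¬a ⊥-elim

  exclude : ∀ s {v} k k′ → k ≢ k′ → Covers dP3 (kiteEdge s k) v → Covers dP3 (kiteEdge s k′) v →
            M (kiteEdge s k) → ¬ M (kiteEdge s k′)
  exclude s k k′ k≢k′ cov cov′ m m′ = k≢k′ (kiteEdge-injective s (unique tt m cov m′ cov′))

  stateWithAD : ∀ s → M (ead s) → Σ KiteState (Meets P M s)
  stateWithAD s mAD = decideBC (M? (ebc s))
    where
    ¬ab   = exclude s ad ab (λ ()) (ad∋a s) (ab∋a s) mAD
    ¬dc   = exclude s ad dc (λ ()) (ad∋d s) (dc∋d s) mAD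
    ¬tail = exclude s ad tail (λ ()) (ad∋d s) (tail∋d s) mAD
    decideBC : Dec (M (ebc s)) → Σ KiteState (Meets P M s)
    decideBC (yes mBC) = stateBy ADBC  λ { ab → ¬ab ; bc → mBC  ; dc → ¬dc ; ad → mAD ; tail → ¬tail }
    decideBC (no ¬bc)  = stateBy AD    λ { ab → ¬ab ; bc → ¬bc ; dc → ¬dc ; ad → mAD ; tail → ¬tail }

  stateWithDC : ∀ s → M (edc s) → Σ KiteState (Meets P M s)
  stateWithDC s mDC = decideAB (M? (eab s))
    where
    ¬bc   = exclude s dc bc (λ ()) (dc∋c s) (bc∋c s) mDC
    ¬ad   = exclude s dc ad (λ ()) (dc∋d s) (ad∋d s) mDC
    ¬tail = exclude s dc tail (λ ()) (dc∋d s) (tail∋d s) mDC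
    decideAB : Dec (M (eab s)) → Σ KiteState (Meets P M s)
    decideAB (yes mAB) = stateBy DCAB  λ { ab → mAB ; bc → ¬bc ; dc → mDC ; ad → ¬ad ; tail → ¬tail }
    decideAB (no ¬ab)  = stateBy DC    λ { ab → ¬ab ; bc → ¬bc ; dc → mDC ; ad → ¬ad ; tail → ¬tail }

  stateWithTail : ∀ s → M (etail s) → Σ KiteState (Meets P M s)
  stateWithTail s mT = decide (M? (eab s)) (M? (ebc s))
    where
    ¬ad = exclude s tail ad (λ ()) (tail∋d s) (ad∋d s) mT
    ¬dc = exclude s tail dc (λ ()) (tail∋d s) (dc∋d s) mT
    decide : Dec (M (eab s)) → Dec (M (ebc s)) → Σ KiteState (Meets P M s)
    decide (yes mAB) (yes mBC) = ⊥-elim (exclude s ab bc (λ ()) (ab∋b s) (bc∋b s) mAB mBC)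
    decide (yes mAB) (no ¬bc)  = stateBy DEAB  λ { ab → mAB ; bc → ¬bc ; dc → ¬dc ; ad → ¬ad ; tail → mT }
    decide (no ¬ab)  (yes mBC) = stateBy DEBC  λ { ab → ¬ab ; bc → mBC ; dc → ¬dc ; ad → ¬ad ; tail → mT }
    decide (no ¬ab)  (no ¬bc)  = stateBy DE    λ { ab → ¬ab ; bc → ¬bc ; dc → ¬dc ; ad → ¬ad ; tail → mT }

  kiteState : ∀ s → Σ KiteState (Meets P M s)
  kiteState s with star-d s (mate-covers (sqd s) tt)
  ... | inj₁ eq        = stateWithAD s (subst M eq (mate∈M _ tt))
  ... | inj₂ (inj₁ eq) = stateWithDC s (subst M eq (mate∈M _ tt))
  ... | inj₂ (inj₂ eq) = stateWithTail s (subst M eq (mate∈M _ tt))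

-- Urban renewal of one kite

module _ {P : OppPair} where

  data Selected : KiteState → Choice P → NewG′ P → Set where
    DE-a′b′   : Selected DE ab∣cd a′b′
    DE-c′d′   : Selected DE ab∣cd c′d′
    DE-d′a′   : Selected DE ad∣bc d′a′
    DE-b′c′   : Selected DE ad∣bc b′c′
    AD-b′c′   : ∀ {c} → Selected AD c b′c′
    DC-a′b′   : ∀ {c} → Selected DC c a′b′
    DEBC-d′a′ : ∀ {c} → Selected DEBC c d′a′
    DEBC-bb′  : ∀ {c} → Selected DEBC c bb′
    DEAB-c′d′ : ∀ {c} → Selected DEAB c c′d′
    DEAB-bb′  : ∀ {c} → Selected DEAB c bb′
    ADBC-bb′  : ∀ {c} → Selected ADBC c bb′
    DCAB-bb′  : ∀ {c} → Selected DCAB c bb′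

  data Touches : NewG′ P → Corner P → Set where
    bb′∋b′  : Touches bb′ b′
    a′b′∋a′ : Touches a′b′ a′
    a′b′∋b′ : Touches a′b′ b′
    b′c′∋b′ : Touches b′c′ b′
    b′c′∋c′ : Touches b′c′ c′
    c′d′∋c′ : Touches c′d′ c′
    c′d′∋d′ : Touches c′d′ d′
    d′a′∋d′ : Touches d′a′ d′
    d′a′∋a′ : Touches d′a′ a′

  selectedAt : KiteState → Choice P → Corner P → Maybe (NewG′ P)
  selectedAt DE ab∣cd = λ { a′ → just a′b′ ; b′ → just a′b′ ; c′ → just c′d′ ; d′ → just c′d′ }
  selectedAt DE ad∣bc = λ { a′ → just d′a′ ; b′ → just b′c′ ; c′ → just b′c′ ; d′ → just d′a′ }
  selectedAt AD   _   = λ { b′ → just b′c′ ; c′ → just b′c′ ; _ → nothing }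
  selectedAt DC   _   = λ { a′ → just a′b′ ; b′ → just a′b′ ; _ → nothing }
  selectedAt DEBC _   = λ { a′ → just d′a′ ; b′ → just bb′  ; d′ → just d′a′ ; _ → nothing }
  selectedAt DEAB _   = λ { b′ → just bb′  ; c′ → just c′d′ ; d′ → just c′d′ ; _ → nothing }
  selectedAt ADBC _   = λ { b′ → just bb′  ; _ → nothing }
  selectedAt DCAB _   = λ { b′ → just bb′  ; _ → nothing }

  selectedAt-touches : ∀ {st c k x} → Selected st c k → Touches k x → selectedAt st c x ≡ just k
  selectedAt-touches DE-a′b′   = λ { a′b′∋a′ → refl ; a′b′∋b′ → refl }
  selectedAt-touches DE-c′d′   = λ { c′d′∋c′ → refl ; c′d′∋d′ → refl }
  selectedAt-touches DE-d′a′   = λ { d′a′∋d′ → refl ; d′a′∋a′ → refl }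
  selectedAt-touches DE-b′c′   = λ { b′c′∋b′ → refl ; b′c′∋c′ → refl }
  selectedAt-touches AD-b′c′   = λ { b′c′∋b′ → refl ; b′c′∋c′ → refl }
  selectedAt-touches DC-a′b′   = λ { a′b′∋a′ → refl ; a′b′∋b′ → refl }
  selectedAt-touches DEBC-d′a′ = λ { d′a′∋d′ → refl ; d′a′∋a′ → refl }
  selectedAt-touches DEBC-bb′  = λ { bb′∋b′ → refl }
  selectedAt-touches DEAB-c′d′ = λ { c′d′∋c′ → refl ; c′d′∋d′ → refl }
  selectedAt-touches DEAB-bb′  = λ { bb′∋b′ → refl }
  selectedAt-touches ADBC-bb′  = λ { bb′∋b′ → refl }
  selectedAt-touches DCAB-bb′  = λ { bb′∋b′ → refl }

  selected-unique : ∀ {st c k k′ x} → Selected st c k → Selected st c k′ →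
                    Touches k x → Touches k′ x → k ≡ k′
  selected-unique sel sel′ t t′ =
    just-injective (trans (sym (selectedAt-touches sel t)) (selectedAt-touches sel′ t′))

  -- x′ is matched inside the renewed square iff x is not matched by an edge of the square
  -- (for d: iff the tail is matched); b′ always is.
  LocallyCovered : KiteState → Corner P → Set
  LocallyCovered st a′ = ¬ T (ab ∈ᵏ st) × ¬ T (ad ∈ᵏ st)
  LocallyCovered st b′ = ⊤
  LocallyCovered st c′ = ¬ T (bc ∈ᵏ st) × ¬ T (dc ∈ᵏ st)
  LocallyCovered st d′ = T (tail ∈ᵏ st)

  covered : ∀ st c x → LocallyCovered st x → Σ (NewG′ P) λ k → Selected st c k × Touches k x
  covered DE   ab∣cd a′ _ = a′b′ , DE-a′b′ , a′b′∋a′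
  covered DE   ab∣cd b′ _ = a′b′ , DE-a′b′ , a′b′∋b′
  covered DE   ab∣cd c′ _ = c′d′ , DE-c′d′ , c′d′∋c′
  covered DE   ab∣cd d′ _ = c′d′ , DE-c′d′ , c′d′∋d′
  covered DE   ad∣bc a′ _ = d′a′ , DE-d′a′ , d′a′∋a′
  covered DE   ad∣bc b′ _ = b′c′ , DE-b′c′ , b′c′∋b′
  covered DE   ad∣bc c′ _ = b′c′ , DE-b′c′ , b′c′∋c′
  covered DE   ad∣bc d′ _ = d′a′ , DE-d′a′ , d′a′∋d′
  covered AD   _ a′ (_ , ¬ad) = ⊥-elim (¬ad tt)
  covered AD   _ b′ _ = b′c′ , AD-b′c′ , b′c′∋b′
  covered AD   _ c′ _ = b′c′ , AD-b′c′ , b′c′∋c′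
  covered AD   _ d′ ()
  covered DC   _ a′ _ = a′b′ , DC-a′b′ , a′b′∋a′
  covered DC   _ b′ _ = a′b′ , DC-a′b′ , a′b′∋b′
  covered DC   _ c′ (_ , ¬dc) = ⊥-elim (¬dc tt)
  covered DC   _ d′ ()
  covered DEBC _ a′ _ = d′a′ , DEBC-d′a′ , d′a′∋a′
  covered DEBC _ b′ _ = bb′ , DEBC-bb′ , bb′∋b′
  covered DEBC _ c′ (¬bc , _) = ⊥-elim (¬bc tt)
  covered DEBC _ d′ _ = d′a′ , DEBC-d′a′ , d′a′∋d′
  covered DEAB _ a′ (¬ab , _) = ⊥-elim (¬ab tt)
  covered DEAB _ b′ _ = bb′ , DEAB-bb′ , bb′∋b′
  covered DEAB _ c′ _ = c′d′ , DEAB-c′d′ , c′d′∋c′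
  covered DEAB _ d′ _ = c′d′ , DEAB-c′d′ , c′d′∋d′
  covered ADBC _ a′ (_ , ¬ad) = ⊥-elim (¬ad tt)
  covered ADBC _ b′ _ = bb′ , ADBC-bb′ , bb′∋b′
  covered ADBC _ c′ (¬bc , _) = ⊥-elim (¬bc tt)
  covered ADBC _ d′ ()
  covered DCAB _ a′ (¬ab , _) = ⊥-elim (¬ab tt)
  covered DCAB _ b′ _ = bb′ , DCAB-bb′ , bb′∋b′
  covered DCAB _ c′ (_ , ¬dc) = ⊥-elim (¬dc tt)
  covered DCAB _ d′ ()

  selected-covered : ∀ {st c k x} → Selected st c k → Touches k x → LocallyCovered st x
  selected-covered DE-a′b′   = λ { a′b′∋a′ → (λ ()) , (λ ()) ; a′b′∋b′ → tt }
  selected-covered DE-c′d′   = λ { c′d′∋c′ → (λ ()) , (λ ()) ; c′d′∋d′ → tt }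
  selected-covered DE-d′a′   = λ { d′a′∋d′ → tt ; d′a′∋a′ → (λ ()) , (λ ()) }
  selected-covered DE-b′c′   = λ { b′c′∋b′ → tt ; b′c′∋c′ → (λ ()) , (λ ()) }
  selected-covered AD-b′c′   = λ { b′c′∋b′ → tt ; b′c′∋c′ → (λ ()) , (λ ()) }
  selected-covered DC-a′b′   = λ { a′b′∋a′ → (λ ()) , (λ ()) ; a′b′∋b′ → tt }
  selected-covered DEBC-d′a′ = λ { d′a′∋d′ → tt ; d′a′∋a′ → (λ ()) , (λ ()) }
  selected-covered DEBC-bb′  = λ { bb′∋b′ → tt }
  selected-covered DEAB-c′d′ = λ { c′d′∋c′ → (λ ()) , (λ ()) ; c′d′∋d′ → tt }
  selected-covered DEAB-bb′  = λ { bb′∋b′ → tt }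
  selected-covered ADBC-bb′  = λ { bb′∋b′ → tt }
  selected-covered DCAB-bb′  = λ { bb′∋b′ → tt }

  selected-bb′ : ∀ {st c} → Selected st c bb′ → T (ab ∈ᵏ st) ⊎ T (bc ∈ᵏ st)
  selected-bb′ DEBC-bb′ = inj₂ tt
  selected-bb′ DEAB-bb′ = inj₁ tt
  selected-bb′ ADBC-bb′ = inj₂ tt
  selected-bb′ DCAB-bb′ = inj₁ tt

  bb′-selected : ∀ st {c} → T (ab ∈ᵏ st) ⊎ T (bc ∈ᵏ st) → Selected st c bb′
  bb′-selected DE   (inj₁ ())
  bb′-selected DE   (inj₂ ())
  bb′-selected AD   (inj₁ ())
  bb′-selected AD   (inj₂ ())
  bb′-selected DC   (inj₁ ())
  bb′-selected DC   (inj₂ ())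
  bb′-selected DEBC _ = DEBC-bb′
  bb′-selected DEAB _ = DEAB-bb′
  bb′-selected ADBC _ = ADBC-bb′
  bb′-selected DCAB _ = DCAB-bb′

data PSqView : (P : OppPair) → PSq P → Set where
  north     : ∀ i j → PSqView NS   (sq i j N  , tt)
  south     : ∀ i j → PSqView NS   (sq i j S  , tt)
  northeast : ∀ i j → PSqView NESW (sq i j NE , tt)
  southwest : ∀ i j → PSqView NESW (sq i j SW , tt)
  northwest : ∀ i j → PSqView NWSE (sq i j NW , tt)
  southeast : ∀ i j → PSqView NWSE (sq i j SE , tt)

view : ∀ {P} (s : PSq P) → PSqView P s
view {NS}   (sq i j N  , _) = north i j
view {NS}   (sq i j S  , _) = south i j
view {NESW} (sq i j NE , _) = northeast i j
view {NESW} (sq i j SW , _) = southwest i j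
view {NWSE} (sq i j NW , _) = northwest i j
view {NWSE} (sq i j SE , _) = southeast i j
view {NS}   (sq _ _ NE , ())
view {NS}   (sq _ _ SE , ())
view {NS}   (sq _ _ SW , ())
view {NS}   (sq _ _ NW , ())
view {NESW} (sq _ _ N  , ())
view {NESW} (sq _ _ SE , ())
view {NESW} (sq _ _ S  , ())
view {NESW} (sq _ _ NW , ())
view {NWSE} (sq _ _ N  , ())
view {NWSE} (sq _ _ NE , ())
view {NWSE} (sq _ _ S  , ())
view {NWSE} (sq _ _ SW , ())

-- The midpoints that survive in G′: the far ends e of the P-tails.
data TailEnd : OppPair → V → Set where
  ns   : ∀ {i j} → TailEnd NS   (m₁ i j)
  nesw : ∀ {i j} → TailEnd NESW (m₃ i j)
  nwse : ∀ {i j} → TailEnd NWSE (m₂ i j)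

-- The edges of G lying on no P-kite.
data Survives : OppPair → EG → Set where
  ns₀     : ∀ {i j} → Survives NS   (ce i j c0)
  ns₁₈₀   : ∀ {i j} → Survives NS   (ce i j c180)
  nesw₁₂₀ : ∀ {i j} → Survives NESW (ce i j c120)
  nesw₃₀₀ : ∀ {i j} → Survives NESW (ce i j c300)
  nwse₆₀  : ∀ {i j} → Survives NWSE (ce i j c60)
  nwse₂₄₀ : ∀ {i j} → Survives NWSE (ce i j c240)

survivor-ends : ∀ {P w} → Survives P w → IsCentre (src w) × TailEnd P (tgt w)
survivor-ends ns₀     = tt , ns
survivor-ends ns₁₈₀   = tt , ns
survivor-ends nesw₁₂₀ = tt , nesw
survivor-ends nesw₃₀₀ = tt , nesw
survivor-ends nwse₆₀  = tt , nwse
survivor-ends nwse₂₄₀ = tt , nwse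

-- Each hexagon vertex d is collapsed onto the far end of its tail.
collapse : OppPair → V → V
collapse _    (ctr i j) = ctr i j
collapse _    (m₁ i j)  = m₁ i j
collapse _    (m₂ i j)  = m₂ i j
collapse _    (m₃ i j)  = m₃ i j
collapse NS   (up i j) = m₁ i j
collapse NS   (dn i j) = m₁ i (j + 1ℤ)
collapse NESW (up i j) = m₃ i j
collapse NESW (dn i j) = m₃ i j
collapse NWSE (up i j) = m₂ i j
collapse NWSE (dn i j) = m₂ (i + 1ℤ) j

collapse-midpoint : ∀ P {v} → IsMidpoint v → collapse P v ≡ v
collapse-midpoint P {m₁ _ _} _ = refl
collapse-midpoint P {m₂ _ _} _ = refl
collapse-midpoint P {m₃ _ _} _ = refl

sqe-collapse : ∀ {P} (s : PSq P) → sqe (proj₁ s) ≡ collapse P (sqd (proj₁ s))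
sqe-collapse s with view s
... | north _ _     = refl
... | south _ _     = refl
... | northeast _ _ = refl
... | southwest _ _ = refl
... | northwest _ _ = refl
... | southeast _ _ = refl

sqe-tailEnd : ∀ {P} (s : PSq P) → TailEnd P (sqe (proj₁ s))
sqe-tailEnd s with view s
... | north _ _     = ns
... | south _ _     = ns
... | northeast _ _ = nesw
... | southwest _ _ = nesw
... | northwest _ _ = nwse
... | southeast _ _ = nwse

sqa-not-tailEnd : ∀ {P} (s : PSq P) → ¬ TailEnd P (sqa (proj₁ s))
sqa-not-tailEnd s with view s
... | north _ _     = λ ()
... | south _ _     = λ ()
... | northeast _ _ = λ ()
... | southwest _ _ = λ ()
... | northwest _ _ = λ ()
... | southeast _ _ = λ ()

sqc-not-tailEnd : ∀ {P} (s : PSq P) → ¬ TailEnd P (sqc (proj₁ s))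
sqc-not-tailEnd s with view s
... | north _ _     = λ ()
... | south _ _     = λ ()
... | northeast _ _ = λ ()
... | southwest _ _ = λ ()
... | northwest _ _ = λ ()
... | southeast _ _ = λ ()

sqd-not-centre : ∀ s → ¬ IsCentre (sqd s)
sqd-not-centre (sq _ _ N)  ()
sqd-not-centre (sq _ _ NE) ()
sqd-not-centre (sq _ _ SE) ()
sqd-not-centre (sq _ _ S)  ()
sqd-not-centre (sq _ _ SW) ()
sqd-not-centre (sq _ _ NW) ()

sqd-not-midpoint : ∀ s → ¬ IsMidpoint (sqd s)
sqd-not-midpoint s mid = src-not-midpoint (etail s) (subst IsMidpoint (sym (etail-ends s)) mid)

centre-not-midpoint : ∀ {z} → IsCentre z → ¬ IsMidpoint z
centre-not-midpoint {ctr _ _} _ ()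

tailEnd-midpoint : ∀ {P z} → TailEnd P z → IsMidpoint z
tailEnd-midpoint ns   = tt
tailEnd-midpoint nesw = tt
tailEnd-midpoint nwse = tt

centre-uncontracted : ∀ {P z} → IsCentre z → ¬ Contracted P (inj₁ z)
centre-uncontracted cz (s , inj₁ eq) =
  centre-not-midpoint cz (subst IsMidpoint (sym (inj₁-injective eq)) (tgt-midpoint (eab (proj₁ s))))
centre-uncontracted cz (s , inj₂ (inj₁ eq)) =
  centre-not-midpoint cz (subst IsMidpoint (sym (inj₁-injective eq)) (tgt-midpoint (ebc (proj₁ s))))
centre-uncontracted cz (s , inj₂ (inj₂ eq)) = sqd-not-centre (proj₁ s) (subst IsCentre (inj₁-injective eq) cz)

tailEnd-uncontracted : ∀ {P z} → TailEnd P z → ¬ Contracted P (inj₁ z)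
tailEnd-uncontracted e (s , inj₁ eq)         = sqa-not-tailEnd s (subst (TailEnd _) (inj₁-injective eq) e)
tailEnd-uncontracted e (s , inj₂ (inj₁ eq)) = sqc-not-tailEnd s (subst (TailEnd _) (inj₁-injective eq) e)
tailEnd-uncontracted e (s , inj₂ (inj₂ eq)) =
  sqd-not-midpoint (proj₁ s) (subst IsMidpoint (inj₁-injective eq) (tailEnd-midpoint e))

vertex-partition : ∀ P z → IsCentre z ⊎ TailEnd P z ⊎ Contracted P (inj₁ z)
vertex-partition _ (ctr _ _) = inj₁ tt
vertex-partition NS (m₁ _ _) = inj₂ (inj₁ ns)
vertex-partition NS (m₂ i j) = inj₂ (inj₂ ((sq i j N , tt) , inj₁ refl))
vertex-partition NS (m₃ i j) =
  inj₂ (inj₂ ((sq (i + 1ℤ) j N , tt) , inj₂ (inj₁ (cong (λ x → inj₁ (m₃ x j)) (sym (+1-1 i))))))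
vertex-partition NS (up i j) =
  inj₂ (inj₂ ((sq i (j + 1ℤ) S , tt) , inj₂ (inj₂ (cong (λ y → inj₁ (up i y)) (sym (+1-1 j))))))
vertex-partition NS (dn i j) =
  inj₂ (inj₂ ((sq (i + 1ℤ) j N , tt) , inj₂ (inj₂ (cong (λ x → inj₁ (dn x j)) (sym (+1-1 i))))))
vertex-partition NESW (m₁ i j) = inj₂ (inj₂ ((sq i j NE , tt) , inj₁ refl))
vertex-partition NESW (m₂ i j) = inj₂ (inj₂ ((sq i j NE , tt) , inj₂ (inj₁ refl)))
vertex-partition NESW (m₃ _ _) = inj₂ (inj₁ nesw)
vertex-partition NESW (up i j) = inj₂ (inj₂ ((sq i j NE , tt) , inj₂ (inj₂ refl)))
vertex-partition NESW (dn i j) =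
  inj₂ (inj₂ ((sq (i + 1ℤ) (j + 1ℤ) SW , tt) ,
    inj₂ (inj₂ (cong₂ (λ x y → inj₁ (dn x y)) (sym (+1-1 i)) (sym (+1-1 j))))))
vertex-partition NWSE (m₁ i j) = inj₂ (inj₂ ((sq i j SE , tt) , inj₂ (inj₁ refl)))
vertex-partition NWSE (m₂ _ _) = inj₂ (inj₁ nwse)
vertex-partition NWSE (m₃ i j) =
  inj₂ (inj₂ ((sq (i + 1ℤ) j NW , tt) , inj₁ (cong (λ x → inj₁ (m₃ x j)) (sym (+1-1 i)))))
vertex-partition NWSE (up i j) =
  inj₂ (inj₂ ((sq (i + 1ℤ) j NW , tt) , inj₂ (inj₂ (cong (λ x → inj₁ (up x j)) (sym (+1-1 i))))))
vertex-partition NWSE (dn i j) =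
  inj₂ (inj₂ ((sq i (j + 1ℤ) SE , tt) , inj₂ (inj₂ (cong (λ y → inj₁ (dn i y)) (sym (+1-1 j))))))

kiteOf : (P : OppPair) → EG → PSq P
kiteOf NS   (ce i j c240) = sq i j S , tt
kiteOf NS   (ce i j c300) = sq i j S , tt
kiteOf NS   (ce i j _)    = sq i j N , tt
kiteOf NS   (ue i j _)    = sq i (j + 1ℤ) S , tt
kiteOf NS   (de i j _)    = sq (i + 1ℤ) j N , tt
kiteOf NESW (ce i j c180) = sq i j SW , tt
kiteOf NESW (ce i j c240) = sq i j SW , tt
kiteOf NESW (ce i j _)    = sq i j NE , tt
kiteOf NESW (ue i j _)    = sq i j NE , tt
kiteOf NESW (de i j _)    = sq (i + 1ℤ) (j + 1ℤ) SW , tt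
kiteOf NWSE (ce i j c300) = sq i j SE , tt
kiteOf NWSE (ce i j c0)   = sq i j SE , tt
kiteOf NWSE (ce i j _)    = sq i j NW , tt
kiteOf NWSE (ue i j _)    = sq (i + 1ℤ) j NW , tt
kiteOf NWSE (de i j _)    = sq i (j + 1ℤ) SE , tt

kindOf : OppPair → EG → KiteEdge
kindOf P w = kindIn (Sq.o (proj₁ (kiteOf P w))) w

kite-partition : ∀ P w → Survives P w ⊎ kiteEdge (proj₁ (kiteOf P w)) (kindOf P w) ≡ w
kite-partition NS (ce _ _ c0)   = inj₁ ns₀
kite-partition NS (ce _ _ c60)  = inj₂ refl
kite-partition NS (ce _ _ c120) = inj₂ refl
kite-partition NS (ce _ _ c180) = inj₁ ns₁₈₀
kite-partition NS (ce _ _ c240) = inj₂ refl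
kite-partition NS (ce _ _ c300) = inj₂ refl
kite-partition NS (ue i j uS ) = inj₂ (cong (λ y → ue i y uS ) (+1-1 j))
kite-partition NS (ue i j uNW) = inj₂ (cong (λ y → ue i y uNW) (+1-1 j))
kite-partition NS (ue i j uNE) = inj₂ (cong (λ y → ue i y uNE) (+1-1 j))
kite-partition NS (de i j dN ) = inj₂ (cong (λ x → de x j dN ) (+1-1 i))
kite-partition NS (de i j dSW) = inj₂ (cong (λ x → de x j dSW) (+1-1 i))
kite-partition NS (de i j dSE) = inj₂ (cong (λ x → de x j dSE) (+1-1 i))
kite-partition NESW (ce _ _ c0)   = inj₂ refl
kite-partition NESW (ce _ _ c60)  = inj₂ refl
kite-partition NESW (ce _ _ c120) = inj₁ nesw₁₂₀
kite-partition NESW (ce _ _ c180) = inj₂ refl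
kite-partition NESW (ce _ _ c240) = inj₂ refl
kite-partition NESW (ce _ _ c300) = inj₁ nesw₃₀₀
kite-partition NESW (ue _ _ uS )   = inj₂ refl
kite-partition NESW (ue _ _ uNW)   = inj₂ refl
kite-partition NESW (ue _ _ uNE)   = inj₂ refl
kite-partition NESW (de i j dN )   = inj₂ (cong₂ (λ x y → de x y dN ) (+1-1 i) (+1-1 j))
kite-partition NESW (de i j dSW)   = inj₂ (cong₂ (λ x y → de x y dSW) (+1-1 i) (+1-1 j))
kite-partition NESW (de i j dSE)   = inj₂ (cong₂ (λ x y → de x y dSE) (+1-1 i) (+1-1 j))
kite-partition NWSE (ce _ _ c0)   = inj₂ refl
kite-partition NWSE (ce _ _ c60)  = inj₁ nwse₆₀
kite-partition NWSE (ce _ _ c120) = inj₂ refl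
kite-partition NWSE (ce _ _ c180) = inj₂ refl
kite-partition NWSE (ce _ _ c240) = inj₁ nwse₂₄₀
kite-partition NWSE (ce _ _ c300) = inj₂ refl
kite-partition NWSE (ue i j uS )   = inj₂ (cong (λ x → ue x j uS ) (+1-1 i))
kite-partition NWSE (ue i j uNW)   = inj₂ (cong (λ x → ue x j uNW) (+1-1 i))
kite-partition NWSE (ue i j uNE)   = inj₂ (cong (λ x → ue x j uNE) (+1-1 i))
kite-partition NWSE (de i j dN )   = inj₂ (cong (λ y → de i y dN ) (+1-1 j))
kite-partition NWSE (de i j dSW)   = inj₂ (cong (λ y → de i y dSW) (+1-1 j))
kite-partition NWSE (de i j dSE)   = inj₂ (cong (λ y → de i y dSE) (+1-1 j))

kiteOf-kiteEdge : ∀ {P} (s : PSq P) k → kiteOf P (kiteEdge (proj₁ s) k) ≡ s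
kiteOf-kiteEdge s with view s
... | north i j = λ { ab → refl ; bc → refl ; dc → shift ; ad → shift ; tail → shift }
  where shift = cong (λ x → sq x j N , tt) (i-1+1 i)
... | south i j = λ { ab → refl ; bc → refl ; dc → shift ; ad → shift ; tail → shift }
  where shift = cong (λ y → sq i y S , tt) (i-1+1 j)
... | northeast i j = λ { ab → refl ; bc → refl ; dc → refl ; ad → refl ; tail → refl }
... | southwest i j = λ { ab → refl ; bc → refl ; dc → shift ; ad → shift ; tail → shift }
  where shift = cong₂ (λ x y → sq x y SW , tt) (i-1+1 i) (i-1+1 j)
... | northwest i j = λ { ab → refl ; bc → refl ; dc → shift ; ad → shift ; tail → shift }
  where shift = cong (λ x → sq x j NW , tt) (i-1+1 i)
... | southeast i j = λ { ab → refl ; bc → refl ; dc → shift ; ad → shift ; tail → shift }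
  where shift = cong (λ y → sq i y SE , tt) (i-1+1 j)

kiteEdge-owner : ∀ {P} (s t : PSq P) {k k′} → kiteEdge (proj₁ s) k ≡ kiteEdge (proj₁ t) k′ → s ≡ t
kiteEdge-owner {P} s t {k} {k′} eq =
  trans (sym (kiteOf-kiteEdge s k)) (trans (cong (kiteOf P) eq) (kiteOf-kiteEdge t k′))

kiteEdge-not-survives : ∀ {P} (s : PSq P) k → ¬ Survives P (kiteEdge (proj₁ s) k)
kiteEdge-not-survives s with view s
... | north _ _     = λ { ab () ; bc () ; dc () ; ad () ; tail () }
... | south _ _     = λ { ab () ; bc () ; dc () ; ad () ; tail () }
... | northeast _ _ = λ { ab () ; bc () ; dc () ; ad () ; tail () }
... | southwest _ _ = λ { ab () ; bc () ; dc () ; ad () ; tail () }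
... | northwest _ _ = λ { ab () ; bc () ; dc () ; ad () ; tail () }
... | southeast _ _ = λ { ab () ; bc () ; dc () ; ad () ; tail () }

data EdgeView (P : OppPair) : EG → Set where
  survivor : ∀ {w} → Survives P w → EdgeView P w
  onKite   : ∀ (s : PSq P) k → EdgeView P (kiteEdge (proj₁ s) k)

edgeView : ∀ P w → EdgeView P w
edgeView P w with kite-partition P w
... | inj₁ sv = survivor sv
... | inj₂ eq = subst (EdgeView P) eq (onKite (kiteOf P w) (kindOf P w))

onKite-not-survives : ∀ {P w} → OnPKite P w → ¬ Survives P w
onKite-not-survives (s , w∈) with ∈kiteEdges w∈
... | k , refl = kiteEdge-not-survives s k

off-kite-survives : ∀ {P} w → .(¬ OnPKite P w) → Survives P w
off-kite-survives {P} w off with edgeView P w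
... | survivor sv = sv
... | onKite s k  = Irrelevant.⊥-elim (off (s , kiteEdge∈kiteEdges (proj₁ s) k))

∈sqEdges : ∀ {s e} → e ∈ sqEdges s → ∃ λ k → k ≢ tail × kiteEdge s k ≡ e
∈sqEdges (here eq)                         = ab , (λ ()) , sym eq
∈sqEdges (there (here eq))                 = bc , (λ ()) , sym eq
∈sqEdges (there (there (here eq)))         = dc , (λ ()) , sym eq
∈sqEdges (there (there (there (here eq)))) = ad , (λ ()) , sym eq

onSquare : ∀ {P} (s : PSq P) k → k ≢ tail → OnPSq P (kiteEdge (proj₁ s) k)
onSquare s ab   _ = s , here refl
onSquare s bc   _ = s , there (here refl)
onSquare s dc   _ = s , there (there (here refl))
onSquare s ad   _ = s , there (there (there (here refl)))
onSquare s tail t = ⊥-elim (t refl)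

tail-off-squares : ∀ {P} (s : PSq P) → ¬ OnPSq P (etail (proj₁ s))
tail-off-squares s (t , e∈) with ∈sqEdges e∈
... | k , k≢tail , eq with kiteEdge-owner t s {k} {tail} eq
...   | refl = k≢tail (kiteEdge-injective (proj₁ s) eq)

from-contracted : ∀ {P} e → Contracted P (inj₁ (src e)) → .(¬ OnPSq P e) → tgt e ≡ collapse P (src e)
from-contracted {P} e con off with edgeView P e
... | survivor sv   = ⊥-elim (centre-uncontracted (proj₁ (survivor-ends sv)) con)
... | onKite s tail = trans (sqe-collapse s) (cong (collapse P) (sym (etail-ends (proj₁ s))))
... | onKite s ab   = Irrelevant.⊥-elim (off (onSquare s ab (λ ())))
... | onKite s bc   = Irrelevant.⊥-elim (off (onSquare s bc (λ ())))
... | onKite s dc   = Irrelevant.⊥-elim (off (onSquare s dc (λ ())))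
... | onKite s ad   = Irrelevant.⊥-elim (off (onSquare s ad (λ ())))

to-contracted : ∀ {P} e → Contracted P (inj₁ (tgt e)) → .(¬ OnPSq P e) → ⊥
to-contracted {P} e con off with edgeView P e
... | survivor sv   = tailEnd-uncontracted (proj₂ (survivor-ends sv)) con
... | onKite s tail = tailEnd-uncontracted (sqe-tailEnd s) con
... | onKite s ab   = Irrelevant.⊥-elim (off (onSquare s ab (λ ())))
... | onKite s bc   = Irrelevant.⊥-elim (off (onSquare s bc (λ ())))
... | onKite s dc   = Irrelevant.⊥-elim (off (onSquare s dc (λ ())))
... | onKite s ad   = Irrelevant.⊥-elim (off (onSquare s ad (λ ())))

centre-edge : ∀ {P} w → IsCentre (src w) →
              Survives P w ⊎ Σ (PSq P) λ s → eab (proj₁ s) ≡ w ⊎ ebc (proj₁ s) ≡ w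
centre-edge {P} w cw with edgeView P w
... | survivor sv   = inj₁ sv
... | onKite s ab   = inj₂ (s , inj₁ refl)
... | onKite s bc   = inj₂ (s , inj₂ refl)
... | onKite s dc   = ⊥-elim (sqd-not-centre (proj₁ s) (subst IsCentre (cong proj₁ (edc-ends (proj₁ s))) cw))
... | onKite s ad   = ⊥-elim (sqd-not-centre (proj₁ s) (subst IsCentre (cong proj₁ (ead-ends (proj₁ s))) cw))
... | onKite s tail = ⊥-elim (sqd-not-centre (proj₁ s) (subst IsCentre (etail-ends (proj₁ s)) cw))

tailEnd-edge : ∀ {P} w → TailEnd P (tgt w) → Survives P w ⊎ Σ (PSq P) λ s → etail (proj₁ s) ≡ w
tailEnd-edge {P} w te with edgeView P w
... | survivor sv   = inj₁ sv
... | onKite s tail = inj₂ (s , refl)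
... | onKite s ab   = ⊥-elim (sqa-not-tailEnd s te)
... | onKite s bc   = ⊥-elim (sqc-not-tailEnd s te)
... | onKite s dc   = ⊥-elim (sqc-not-tailEnd s (subst (TailEnd P) (cong proj₂ (edc-ends (proj₁ s))) te))
... | onKite s ad   = ⊥-elim (sqa-not-tailEnd s (subst (TailEnd P) (cong proj₂ (ead-ends (proj₁ s))) te))

-- A slot is a P-square with a role a or c; the slots at a contracted midpoint are a square and its partner.

data Role : Set where
  rA rC : Role

vertexOf : Role → Sq → V
vertexOf rA = sqa
vertexOf rC = sqc

long short : Role → KiteEdge
long  rA = ab
long  rC = bc
short rA = ad
short rC = dc

corner : ∀ {P} → Role → Corner P
corner rA = a′
corner rC = c′

partnerSquare : ∀ {P} → PSq P → Role → PSq P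
partnerSquare s R with view s
partnerSquare _ rA | north i j     = sq i (j + 1ℤ) S , tt
partnerSquare _ rC | north i j     = sq (i - 1ℤ) (j + 1ℤ) S , tt
partnerSquare _ rA | south i j     = sq i (j - 1ℤ) N , tt
partnerSquare _ rC | south i j     = sq (i + 1ℤ) (j - 1ℤ) N , tt
partnerSquare _ rA | northeast i j = sq (i + 1ℤ) j SW , tt
partnerSquare _ rC | northeast i j = sq i (j + 1ℤ) SW , tt
partnerSquare _ rA | southwest i j = sq (i - 1ℤ) j NE , tt
partnerSquare _ rC | southwest i j = sq i (j - 1ℤ) NE , tt
partnerSquare _ rA | northwest i j = sq (i - 1ℤ) (j + 1ℤ) SE , tt
partnerSquare _ rC | northwest i j = sq (i - 1ℤ) j SE , tt
partnerSquare _ rA | southeast i j = sq (i + 1ℤ) (j - 1ℤ) NW , tt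
partnerSquare _ rC | southeast i j = sq (i + 1ℤ) j NW , tt

partner-vertex : ∀ {P} (s : PSq P) R → vertexOf R (proj₁ (partnerSquare s R)) ≡ vertexOf R (proj₁ s)
partner-vertex s R with view s
partner-vertex _ rA | north i j     = cong (m₂ i) (+1-1 j)
partner-vertex _ rC | north i j     = cong (m₃ (i - 1ℤ)) (+1-1 j)
partner-vertex _ rA | south i j     = refl
partner-vertex _ rC | south i j     = cong (λ x → m₃ x (j - 1ℤ)) (+1-1 i)
partner-vertex _ rA | northeast i j = cong (λ x → m₁ x j) (+1-1 i)
partner-vertex _ rC | northeast i j = cong (m₂ i) (+1-1 j)
partner-vertex _ rA | southwest i j = refl
partner-vertex _ rC | southwest i j = refl
partner-vertex _ rA | northwest i j = cong (m₃ (i - 1ℤ)) (+1-1 j)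
partner-vertex _ rC | northwest i j = refl
partner-vertex _ rA | southeast i j = cong (λ x → m₃ x (j - 1ℤ)) (+1-1 i)
partner-vertex _ rC | southeast i j = cong (λ x → m₁ x j) (+1-1 i)

partner-≢ : ∀ {P} (s : PSq P) R → partnerSquare s R ≢ s
partner-≢ s R with view s
partner-≢ _ rA | north _ _     = λ ()
partner-≢ _ rC | north _ _     = λ ()
partner-≢ _ rA | south _ _     = λ ()
partner-≢ _ rC | south _ _     = λ ()
partner-≢ _ rA | northeast _ _ = λ ()
partner-≢ _ rC | northeast _ _ = λ ()
partner-≢ _ rA | southwest _ _ = λ ()
partner-≢ _ rC | southwest _ _ = λ ()
partner-≢ _ rA | northwest _ _ = λ ()
partner-≢ _ rC | northwest _ _ = λ ()
partner-≢ _ rA | southeast _ _ = λ ()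
partner-≢ _ rC | southeast _ _ = λ ()

roleAt : OppPair → V → Role
roleAt NS   (m₃ _ _) = rC
roleAt NESW (m₂ _ _) = rC
roleAt NWSE (m₁ _ _) = rC
roleAt _    _        = rA

roleAt-vertexOf : ∀ {P} (s : PSq P) R → roleAt P (vertexOf R (proj₁ s)) ≡ R
roleAt-vertexOf s with view s
... | north _ _     = λ { rA → refl ; rC → refl }
... | south _ _     = λ { rA → refl ; rC → refl }
... | northeast _ _ = λ { rA → refl ; rC → refl }
... | southwest _ _ = λ { rA → refl ; rC → refl }
... | northwest _ _ = λ { rA → refl ; rC → refl }
... | southeast _ _ = λ { rA → refl ; rC → refl }

same-vertex-role : ∀ {P} (s t : PSq P) R R′ → vertexOf R (proj₁ s) ≡ vertexOf R′ (proj₁ t) → R ≡ R′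
same-vertex-role {P} s t R R′ eq =
  trans (sym (roleAt-vertexOf s R)) (trans (cong (roleAt P) eq) (roleAt-vertexOf t R′))

m₁-injective : ∀ {i j i′ j′} → m₁ i j ≡ m₁ i′ j′ → i ≡ i′ × j ≡ j′
m₁-injective refl = refl , refl

m₂-injective : ∀ {i j i′ j′} → m₂ i j ≡ m₂ i′ j′ → i ≡ i′ × j ≡ j′
m₂-injective refl = refl , refl

m₃-injective : ∀ {i j i′ j′} → m₃ i j ≡ m₃ i′ j′ → i ≡ i′ × j ≡ j′
m₃-injective refl = refl , refl

square-cong : ∀ {P o} {p : o ∈ₚ P} {i i′ j j′} → i ≡ i′ → j ≡ j′ →
              _≡_ {A = PSq P} (sq i j o , p) (sq i′ j′ o , p)
square-cong refl refl = refl

same-vertex : ∀ {P} (s t : PSq P) R → vertexOf R (proj₁ s) ≡ vertexOf R (proj₁ t) →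
              t ≡ s ⊎ t ≡ partnerSquare s R
same-vertex s t R eq with view s | view t
same-vertex _ _ rA refl | north i j     | north _ _     = inj₁ refl
same-vertex _ _ rC eq   | north i j     | north _ _     with m₃-injective eq
... | p , q = inj₁ (square-cong (sym (-1-injective p)) (sym q))
same-vertex _ _ rA refl | north i _     | south _ j′    = inj₂ (cong (λ y → sq i y S , tt) (sym (i-1+1 j′)))
same-vertex _ _ rC refl | north i _     | south _ j′    = inj₂ (cong (λ y → sq (i - 1ℤ) y S , tt) (sym (i-1+1 j′)))
same-vertex _ _ rA refl | south i j     | north _ _     = inj₂ refl
same-vertex _ _ rC refl | south _ j     | north i′ _    = inj₂ (cong (λ x → sq x (j - 1ℤ) N , tt) (sym (i-1+1 i′)))
same-vertex _ _ rA eq   | south i j     | south _ _     with m₂-injective eq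
... | p , q = inj₁ (square-cong (sym p) (sym (-1-injective q)))
same-vertex _ _ rC eq   | south i j     | south _ _     with m₃-injective eq
... | p , q = inj₁ (square-cong (sym p) (sym (-1-injective q)))
same-vertex _ _ rA refl | northeast i j | northeast _ _ = inj₁ refl
same-vertex _ _ rC refl | northeast i j | northeast _ _ = inj₁ refl
same-vertex _ _ rA refl | northeast _ j | southwest i′ _ = inj₂ (cong (λ x → sq x j SW , tt) (sym (i-1+1 i′)))
same-vertex _ _ rC refl | northeast i _ | southwest _ j′ = inj₂ (cong (λ y → sq i y SW , tt) (sym (i-1+1 j′)))
same-vertex _ _ rA refl | southwest i j | northeast _ _ = inj₂ refl
same-vertex _ _ rC refl | southwest i j | northeast _ _ = inj₂ refl
same-vertex _ _ rA eq   | southwest i j | southwest _ _ with m₁-injective eq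
... | p , q = inj₁ (square-cong (sym (-1-injective p)) (sym q))
same-vertex _ _ rC eq   | southwest i j | southwest _ _ with m₂-injective eq
... | p , q = inj₁ (square-cong (sym p) (sym (-1-injective q)))
same-vertex _ _ rA eq   | northwest i j | northwest _ _ with m₃-injective eq
... | p , q = inj₁ (square-cong (sym (-1-injective p)) (sym q))
same-vertex _ _ rC eq   | northwest i j | northwest _ _ with m₁-injective eq
... | p , q = inj₁ (square-cong (sym (-1-injective p)) (sym q))
same-vertex _ _ rA refl | northwest i _ | southeast _ j′ = inj₂ (cong (λ y → sq (i - 1ℤ) y SE , tt) (sym (i-1+1 j′)))
same-vertex _ _ rC refl | northwest i j | southeast _ _ = inj₂ refl
same-vertex _ _ rA refl | southeast _ j | northwest i′ _ = inj₂ (cong (λ x → sq x (j - 1ℤ) NW , tt) (sym (i-1+1 i′)))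
same-vertex _ _ rC refl | southeast _ j | northwest i′ _ = inj₂ (cong (λ x → sq x j NW , tt) (sym (i-1+1 i′)))
same-vertex _ _ rA eq   | southeast i j | southeast _ _ with m₃-injective eq
... | p , q = inj₁ (square-cong (sym p) (sym (-1-injective q)))
same-vertex _ _ rC eq   | southeast i j | southeast _ _ with m₁-injective eq
... | p , q = inj₁ (square-cong (sym p) (sym q))

vertexOf-midpoint : ∀ R s → IsMidpoint (vertexOf R s)
vertexOf-midpoint rA s = tgt-midpoint (eab s)
vertexOf-midpoint rC s = tgt-midpoint (ebc s)

vertexOf-not-tailEnd : ∀ {P} (s : PSq P) R → ¬ TailEnd P (vertexOf R (proj₁ s))
vertexOf-not-tailEnd s rA = sqa-not-tailEnd s
vertexOf-not-tailEnd s rC = sqc-not-tailEnd s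

long∋vertex : ∀ R s → Covers dP3 (kiteEdge s (long R)) (vertexOf R s)
long∋vertex rA s = ab∋a s
long∋vertex rC s = bc∋c s

short∋vertex : ∀ R s → Covers dP3 (kiteEdge s (short R)) (vertexOf R s)
short∋vertex rA s = ad∋a s
short∋vertex rC s = dc∋c s

SlotEdge : ∀ {P} → PSq P → Role → EG → Set
SlotEdge t R w = kiteEdge (proj₁ t) (long R) ≡ w ⊎ kiteEdge (proj₁ t) (short R) ≡ w

slot-of-edge : ∀ {P} (s t : PSq P) R R′ {w} → SlotEdge t R′ w →
               vertexOf R′ (proj₁ t) ≡ vertexOf R (proj₁ s) →
               Σ (PSq P) λ u → (u ≡ s ⊎ u ≡ partnerSquare s R) × SlotEdge u R w
slot-of-edge s t R R′ e eq with same-vertex-role s t R R′ (sym eq)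
... | refl = t , same-vertex s t R (sym eq) , e

slot-star : ∀ {P} (s : PSq P) R {w} → Covers dP3 w (vertexOf R (proj₁ s)) →
            Σ (PSq P) λ u → (u ≡ s ⊎ u ≡ partnerSquare s R) × SlotEdge u R w
slot-star {P} s R {w} cov with edgeView P w | covers-midpoint w (vertexOf-midpoint R (proj₁ s)) cov
... | survivor sv   | eq = ⊥-elim (vertexOf-not-tailEnd s R (subst (TailEnd P) eq (proj₂ (survivor-ends sv))))
... | onKite t tail | eq = ⊥-elim (vertexOf-not-tailEnd s R (subst (TailEnd P) eq (sqe-tailEnd t)))
... | onKite t ab   | eq = slot-of-edge s t R rA (inj₁ refl) eq
... | onKite t bc   | eq = slot-of-edge s t R rC (inj₁ refl) eq
... | onKite t ad   | eq = slot-of-edge s t R rA (inj₂ refl) (trans (cong proj₂ (sym (ead-ends (proj₁ t)))) eq)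
... | onKite t dc   | eq = slot-of-edge s t R rC (inj₂ refl) (trans (cong proj₂ (sym (edc-ends (proj₁ t)))) eq)

centre-not-slot : ∀ {P z} → IsCentre z → ∀ (s : PSq P) R → z ≢ vertexOf R (proj₁ s)
centre-not-slot cz s R refl = centre-not-midpoint cz (vertexOf-midpoint R (proj₁ s))

tailEnd-not-slot : ∀ {P z} → TailEnd P z → ∀ (s : PSq P) R → z ≢ vertexOf R (proj₁ s)
tailEnd-not-slot te s R refl = vertexOf-not-tailEnd s R te

sqb-centre : ∀ s → IsCentre (sqb s)
sqb-centre (sq _ _ _) = tt

≡⇒EqClosure : ∀ {A : Set} {R : A → A → Set} {x y} → x ≡ y → EqClosure R x y
≡⇒EqClosure refl = ε

-- The renewed matching

module Renewal (P : OppPair) {M : EG → Set} (pm : IsPerfectMatching dP3 M) (ch : PSq P → Choice P) where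
  open PerfectMatching {G = dP3} pm
  open KiteStates pm P

  Mʳ : E′ P → Set
  Mʳ = M′ P M ch

  state : PSq P → KiteState
  state s = proj₁ (kiteState (proj₁ s))

  matched⇔ : ∀ s k → M (kiteEdge (proj₁ s) k) ⇔ T (k ∈ᵏ state s)
  matched⇔ s = Equivalence.to (meets⇔ P M) (proj₂ (kiteState (proj₁ s)))

  M′-selected : ∀ s k → Mʳ (inj₂ (s , k)) → Σ KiteState λ st → Meets P M (proj₁ s) st × Selected st (ch s) k
  M′-selected s a′b′ (inj₁ (m , c)) rewrite c = DE , m , DE-a′b′
  M′-selected s a′b′ (inj₂ m)                 = DC , m , DC-a′b′
  M′-selected s c′d′ (inj₁ (m , c)) rewrite c = DE , m , DE-c′d′
  M′-selected s c′d′ (inj₂ m)                 = DEAB , m , DEAB-c′d′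
  M′-selected s d′a′ (inj₁ (m , c)) rewrite c = DE , m , DE-d′a′
  M′-selected s d′a′ (inj₂ m)                 = DEBC , m , DEBC-d′a′
  M′-selected s b′c′ (inj₁ (m , c)) rewrite c = DE , m , DE-b′c′
  M′-selected s b′c′ (inj₂ m)                 = AD , m , AD-b′c′
  M′-selected s bb′ (inj₁ m)                  = DEBC , m , DEBC-bb′
  M′-selected s bb′ (inj₂ (inj₁ m))           = DEAB , m , DEAB-bb′
  M′-selected s bb′ (inj₂ (inj₂ (inj₁ m)))    = ADBC , m , ADBC-bb′
  M′-selected s bb′ (inj₂ (inj₂ (inj₂ m)))    = DCAB , m , DCAB-bb′

  selected-M′ : ∀ {s st c k} → Meets P M (proj₁ s) st → Selected st c k → c ≡ ch s → Mʳ (inj₂ (s , k))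
  selected-M′ m DE-a′b′   c = inj₁ (m , sym c)
  selected-M′ m DE-c′d′   c = inj₁ (m , sym c)
  selected-M′ m DE-d′a′   c = inj₁ (m , sym c)
  selected-M′ m DE-b′c′   c = inj₁ (m , sym c)
  selected-M′ m AD-b′c′   _ = inj₂ m
  selected-M′ m DC-a′b′   _ = inj₂ m
  selected-M′ m DEBC-d′a′ _ = inj₂ m
  selected-M′ m DEAB-c′d′ _ = inj₂ m
  selected-M′ m DEBC-bb′  _ = inj₁ m
  selected-M′ m DEAB-bb′  _ = inj₂ (inj₁ m)
  selected-M′ m ADBC-bb′  _ = inj₂ (inj₂ (inj₁ m))
  selected-M′ m DCAB-bb′  _ = inj₂ (inj₂ (inj₂ m))

  selected⇔ : ∀ s k → Mʳ (inj₂ (s , k)) ⇔ Selected (state s) (ch s) k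
  selected⇔ s k = mk⇔ to (λ sel → selected-M′ (proj₂ (kiteState (proj₁ s))) sel refl)
    where
    to : Mʳ (inj₂ (s , k)) → Selected (state s) (ch s) k
    to m with M′-selected s k m
    ... | st , meets , sel =
      subst (λ st → Selected st (ch s) k) (meets-unique P M meets (proj₂ (kiteState (proj₁ s)))) sel

  selected : ∀ {s k} → Mʳ (inj₂ (s , k)) → Selected (state s) (ch s) k
  selected = Equivalence.to (selected⇔ _ _)

  classOf : VH P → VH P
  classOf (inj₁ v)        = inj₁ v
  classOf (inj₂ (s , a′)) = inj₁ (sqa (proj₁ s))
  classOf (inj₂ (s , b′)) = inj₂ (s , b′)
  classOf (inj₂ (s , c′)) = inj₁ (sqc (proj₁ s))
  classOf (inj₂ (s , d′)) = inj₁ (sqe (proj₁ s))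

  neighbour-class : ∀ w x → Contracted P (inj₁ w) → AdjH P (inj₁ w) x → classOf x ≡ inj₁ (collapse P w)
  neighbour-class _ _ con (inj₁ (keepH e off) , inj₁ refl) = cong inj₁ (from-contracted e con off)
  neighbour-class _ _ con (inj₁ (keepH e off) , inj₂ refl) = ⊥-elim (to-contracted e con off)
  neighbour-class _ _ con (inj₂ (s , aa′) , inj₁ refl) =
    cong inj₁ (sym (collapse-midpoint P (tgt-midpoint (eab (proj₁ s)))))
  neighbour-class _ _ con (inj₂ (s , bb′) , inj₁ refl) = ⊥-elim (centre-uncontracted (sqb-centre (proj₁ s)) con)
  neighbour-class _ _ con (inj₂ (s , cc′) , inj₁ refl) =
    cong inj₁ (sym (collapse-midpoint P (tgt-midpoint (ebc (proj₁ s)))))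
  neighbour-class _ _ con (inj₂ (s , dd′) , inj₁ refl) = cong inj₁ (sqe-collapse s)
  neighbour-class _ _ _ (inj₂ (_ , aa′)  , inj₂ ())
  neighbour-class _ _ _ (inj₂ (_ , bb′)  , inj₂ ())
  neighbour-class _ _ _ (inj₂ (_ , cc′)  , inj₂ ())
  neighbour-class _ _ _ (inj₂ (_ , dd′)  , inj₂ ())
  neighbour-class _ _ _ (inj₂ (_ , a′b′) , inj₁ ())
  neighbour-class _ _ _ (inj₂ (_ , a′b′) , inj₂ ())
  neighbour-class _ _ _ (inj₂ (_ , b′c′) , inj₁ ())
  neighbour-class _ _ _ (inj₂ (_ , b′c′) , inj₂ ())
  neighbour-class _ _ _ (inj₂ (_ , c′d′) , inj₁ ())
  neighbour-class _ _ _ (inj₂ (_ , c′d′) , inj₂ ())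
  neighbour-class _ _ _ (inj₂ (_ , d′a′) , inj₁ ())
  neighbour-class _ _ _ (inj₂ (_ , d′a′) , inj₂ ())

  ident-class : ∀ {x y} → Ident P x y → classOf x ≡ classOf y
  ident-class (inj₁ w , con , wx , wy) = trans (neighbour-class w _ con wx) (sym (neighbour-class w _ con wy))
  ident-class (inj₂ _ , (_ , inj₁ ()) , _)
  ident-class (inj₂ _ , (_ , inj₂ (inj₁ ())) , _)
  ident-class (inj₂ _ , (_ , inj₂ (inj₂ ())) , _)

  class-respects : ∀ {x y} → EqClosure (Ident P) x y → classOf x ≡ classOf y
  class-respects = gfold isEquivalence classOf ident-class

  corner-adjacent : ∀ s R → AdjH P (inj₁ (vertexOf R (proj₁ s))) (inj₂ (s , corner R))
  corner-adjacent s rA = inj₂ (s , aa′) , inj₁ refl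
  corner-adjacent s rC = inj₂ (s , cc′) , inj₁ refl

  corner-contracted : ∀ s R → Contracted P (inj₁ (vertexOf R (proj₁ s)))
  corner-contracted s rA = s , inj₁ refl
  corner-contracted s rC = s , inj₂ (inj₁ refl)

  corners-identified : ∀ s t R → vertexOf R (proj₁ s) ≡ vertexOf R (proj₁ t) →
                       Ident P (inj₂ (s , corner R)) (inj₂ (t , corner R))
  corners-identified s t R eq =
    inj₁ (vertexOf R (proj₁ s)) , corner-contracted s R , corner-adjacent s R ,
    subst (λ z → AdjH P (inj₁ z) (inj₂ (t , corner R))) (sym eq) (corner-adjacent t R)

  d′-identified : ∀ s → Ident P (inj₂ (s , d′)) (inj₁ (sqe (proj₁ s)))
  d′-identified s =
    inj₁ (sqd (proj₁ s)) , (s , inj₂ (inj₂ refl)) , (inj₂ (s , dd′) , inj₁ refl) ,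
    (inj₁ (keepH (etail (proj₁ s)) (tail-off-squares s)) ,
     inj₁ (cong (λ z → inj₁ z , inj₁ (sqe (proj₁ s))) (etail-ends (proj₁ s))))

  Covered : VH P → Set
  Covered v = Σ (E′ P) λ f → Mʳ f × Covers (G′ P) f v

  covered-≈ : ∀ {x y} → Covered x → EqClosure (Ident P) x y → Covered y
  covered-≈ (f , m , inj₁ p) q = f , m , inj₁ (p ◅◅ q)
  covered-≈ (f , m , inj₂ p) q = f , m , inj₂ (p ◅◅ q)

  touches-covers : ∀ {s k x} → Touches k x → Covers (G′ P) (inj₂ (s , k)) (inj₂ (s , x))
  touches-covers bb′∋b′  = inj₂ ε
  touches-covers a′b′∋a′ = inj₁ ε
  touches-covers a′b′∋b′ = inj₂ ε
  touches-covers b′c′∋b′ = inj₁ ε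
  touches-covers b′c′∋c′ = inj₂ ε
  touches-covers c′d′∋c′ = inj₁ ε
  touches-covers c′d′∋d′ = inj₂ ε
  touches-covers d′a′∋d′ = inj₁ ε
  touches-covers d′a′∋a′ = inj₂ ε

  corner-covered : ∀ s x → LocallyCovered (state s) x → Covered (inj₂ (s , x))
  corner-covered s x lc with covered (state s) (ch s) x lc
  ... | k , sel , t = inj₂ (s , k) , Equivalence.from (selected⇔ s k) sel , touches-covers t

  SlotFree : PSq P → Role → Set
  SlotFree s R = ¬ M (kiteEdge (proj₁ s) (long R)) × ¬ M (kiteEdge (proj₁ s) (short R))

  free-slot-covered : ∀ s R → SlotFree s R → Covered (inj₂ (s , corner R))
  free-slot-covered s rA (¬ab , ¬ad) =
    corner-covered s a′ (¬ab ∘ Equivalence.from (matched⇔ s ab) , ¬ad ∘ Equivalence.from (matched⇔ s ad))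
  free-slot-covered s rC (¬bc , ¬dc) =
    corner-covered s c′ (¬bc ∘ Equivalence.from (matched⇔ s bc) , ¬dc ∘ Equivalence.from (matched⇔ s dc))

  partner-free : ∀ s R k → M (kiteEdge (proj₁ s) k) → Covers dP3 (kiteEdge (proj₁ s) k) (vertexOf R (proj₁ s)) →
                 SlotFree (partnerSquare s R) R
  partner-free s R k m cov = clash (long R) (long∋vertex R _) , clash (short R) (short∋vertex R _)
    where
    p = partnerSquare s R
    clash : ∀ k′ → Covers dP3 (kiteEdge (proj₁ p) k′) (vertexOf R (proj₁ p)) → ¬ M (kiteEdge (proj₁ p) k′)
    clash k′ cov′ m′ = partner-≢ s R (kiteEdge-owner p s {k′} {k}
      (unique tt m′ (subst (Covers dP3 (kiteEdge (proj₁ p) k′)) (partner-vertex s R) cov′) m cov))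

  covered-via-partner : ∀ s R → SlotFree (partnerSquare s R) R → Covered (inj₂ (s , corner R))
  covered-via-partner s R free = covered-≈ (free-slot-covered _ R free)
    (bwd (corners-identified s (partnerSquare s R) R (sym (partner-vertex s R))) ◅ ε)

  slot-covered : ∀ s R → Covered (inj₂ (s , corner R))
  slot-covered s R with M? (kiteEdge (proj₁ s) (long R)) | M? (kiteEdge (proj₁ s) (short R))
  ... | no ¬l | no ¬sh = free-slot-covered s R (¬l , ¬sh)
  ... | yes m | _      = covered-via-partner s R (partner-free s R (long R) m (long∋vertex R _))
  ... | no _  | yes m  = covered-via-partner s R (partner-free s R (short R) m (short∋vertex R _))

  centre-covered : ∀ z → IsCentre z → Covered (inj₁ z)
  centre-covered z cz = by (centre-edge {P} w (subst IsCentre (sym w-src) cz))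
    where
    w = mate z tt
    w-src : src w ≡ z
    w-src = covers-non-midpoint w (centre-not-midpoint cz) (mate-covers z tt)
    spoke : ∀ s → T (ab ∈ᵏ state s) ⊎ T (bc ∈ᵏ state s) → sqb (proj₁ s) ≡ z → Covered (inj₁ z)
    spoke s long∈ eq = inj₂ (s , bb′) , Equivalence.from (selected⇔ s bb′) (bb′-selected (state s) long∈) ,
                       inj₁ (≡⇒EqClosure (cong inj₁ eq))
    by : Survives P w ⊎ Σ (PSq P) (λ s → eab (proj₁ s) ≡ w ⊎ ebc (proj₁ s) ≡ w) → Covered (inj₁ z)
    by (inj₁ sv) = inj₁ (keep w (λ on → onKite-not-survives on sv)) , mate∈M z tt ,
                   inj₁ (≡⇒EqClosure (cong inj₁ w-src))
    by (inj₂ (s , inj₁ eq)) =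
      spoke s (inj₁ (Equivalence.to (matched⇔ s ab) (subst M (sym eq) (mate∈M z tt))))
              (trans (sym (proj₁ (src-long (proj₁ s)))) (trans (cong src eq) w-src))
    by (inj₂ (s , inj₂ eq)) =
      spoke s (inj₂ (Equivalence.to (matched⇔ s bc) (subst M (sym eq) (mate∈M z tt))))
              (trans (sym (proj₂ (src-long (proj₁ s)))) (trans (cong src eq) w-src))

  tailEnd-covered : ∀ z → TailEnd P z → Covered (inj₁ z)
  tailEnd-covered z te = by (tailEnd-edge {P} w (subst (TailEnd P) (sym w-tgt) te))
    where
    w = mate z tt
    w-tgt : tgt w ≡ z
    w-tgt = covers-midpoint w (tailEnd-midpoint te) (mate-covers z tt)
    by : Survives P w ⊎ Σ (PSq P) (λ s → etail (proj₁ s) ≡ w) → Covered (inj₁ z)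
    by (inj₁ sv) = inj₁ (keep w (λ on → onKite-not-survives on sv)) , mate∈M z tt ,
                   inj₂ (≡⇒EqClosure (cong inj₁ w-tgt))
    by (inj₂ (s , eq)) =
      covered-≈ (corner-covered s d′ (Equivalence.to (matched⇔ s tail) (subst M (sym eq) (mate∈M z tt))))
                (fwd (d′-identified s) ◅ ≡⇒EqClosure (cong inj₁ (trans (cong tgt eq) w-tgt)))

  every-vertex-covered : ∀ v → ¬ Contracted P v → Covered v
  every-vertex-covered (inj₁ z) uncontracted with vertex-partition P z
  ... | inj₁ cz         = centre-covered z cz
  ... | inj₂ (inj₁ te)  = tailEnd-covered z te
  ... | inj₂ (inj₂ con) = ⊥-elim (uncontracted con)
  every-vertex-covered (inj₂ (s , a′)) _ = slot-covered s rA
  every-vertex-covered (inj₂ (s , b′)) _ = corner-covered s b′ tt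
  every-vertex-covered (inj₂ (s , c′)) _ = slot-covered s rC
  every-vertex-covered (inj₂ (s , d′)) _ =
    covered-≈ (tailEnd-covered _ (sqe-tailEnd s)) (bwd (d′-identified s) ◅ ε)

  data FromCentre (z : V) : E′ P → Set where
    kept  : ∀ e → src (EGsurv.edge e) ≡ z → FromCentre z (inj₁ e)
    spoke : ∀ s → sqb (proj₁ s) ≡ z → FromCentre z (inj₂ (s , bb′))

  data IntoTailEnd (z : V) : E′ P → Set where
    kept  : ∀ e → tgt (EGsurv.edge e) ≡ z → IntoTailEnd z (inj₁ e)
    fromD : ∀ s {k} → Touches k d′ → sqe (proj₁ s) ≡ z → IntoTailEnd z (inj₂ (s , k))

  data Meeting : VH P → E′ P → Set where
    atInner   : ∀ s {k} → Touches k b′ → Meeting (inj₂ (s , b′)) (inj₂ (s , k))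
    atCentre  : ∀ {z f} → IsCentre z → FromCentre z f → Meeting (inj₁ z) f
    atTailEnd : ∀ {z f} → TailEnd P z → IntoTailEnd z f → Meeting (inj₁ z) f
    atSlot    : ∀ {c} s R {k} → Touches k (corner R) → c ≡ inj₁ (vertexOf R (proj₁ s)) →
                Meeting c (inj₂ (s , k))

  endpoint : Bool → E′ P → VH P
  endpoint true  f = proj₁ (ends′ P f)
  endpoint false f = proj₂ (ends′ P f)

  meeting : ∀ f e → Meeting (classOf (endpoint e f)) f
  meeting (inj₁ (keep w off)) true  = atCentre (proj₁ (survivor-ends (off-kite-survives w off))) (kept _ refl)
  meeting (inj₁ (keep w off)) false = atTailEnd (proj₂ (survivor-ends (off-kite-survives w off))) (kept _ refl)
  meeting (inj₂ (s , bb′))  true  = atCentre (sqb-centre (proj₁ s)) (spoke s refl)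
  meeting (inj₂ (s , bb′))  false = atInner s bb′∋b′
  meeting (inj₂ (s , a′b′)) true  = atSlot s rA a′b′∋a′ refl
  meeting (inj₂ (s , a′b′)) false = atInner s a′b′∋b′
  meeting (inj₂ (s , b′c′)) true  = atInner s b′c′∋b′
  meeting (inj₂ (s , b′c′)) false = atSlot s rC b′c′∋c′ refl
  meeting (inj₂ (s , c′d′)) true  = atSlot s rC c′d′∋c′ refl
  meeting (inj₂ (s , c′d′)) false = atTailEnd (sqe-tailEnd s) (fromD s c′d′∋d′ refl)
  meeting (inj₂ (s , d′a′)) true  = atTailEnd (sqe-tailEnd s) (fromD s d′a′∋d′ refl)
  meeting (inj₂ (s , d′a′)) false = atSlot s rA d′a′∋a′ refl

  covering-end : ∀ {f v} → Covers (G′ P) f v → Σ Bool λ e → classOf (endpoint e f) ≡ classOf v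
  covering-end (inj₁ p) = true  , class-respects p
  covering-end (inj₂ p) = false , class-respects p

  same-square-unique : ∀ s {k k′ x} → Mʳ (inj₂ (s , k)) → Mʳ (inj₂ (s , k′)) → Touches k x → Touches k′ x →
                 _≡_ {A = E′ P} (inj₂ (s , k)) (inj₂ (s , k′))
  same-square-unique s mf mg t t′ = cong (λ k → inj₂ (s , k)) (selected-unique (selected mf) (selected mg) t t′)

  kept-unique : ∀ {e e′ : EGsurv P} → EGsurv.edge e ≡ EGsurv.edge e′ → _≡_ {A = E′ P} (inj₁ e) (inj₁ e′)
  kept-unique {keep w _} {keep .w _} refl = refl

  kept-off-kite : ∀ {w v} → .(¬ OnPKite P w) → M w → Covers dP3 w v →
                  ∀ s k → M (kiteEdge (proj₁ s) k) → ¬ Covers dP3 (kiteEdge (proj₁ s) k) v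
  kept-off-kite off m cov s k m′ cov′ = Irrelevant.⊥-elim (off (s ,
    subst (_∈ kiteEdges (proj₁ s)) (unique tt m′ cov′ m cov) (kiteEdge∈kiteEdges (proj₁ s) k)))

  spoke-edge : ∀ s {z} → Mʳ (inj₂ (s , bb′)) → sqb (proj₁ s) ≡ z →
               Σ KiteEdge λ k → M (kiteEdge (proj₁ s) k) × Covers dP3 (kiteEdge (proj₁ s) k) z
  spoke-edge s m refl with selected-bb′ (selected {s} m)
  ... | inj₁ t = ab , Equivalence.from (matched⇔ s ab) t , ab∋b (proj₁ s)
  ... | inj₂ t = bc , Equivalence.from (matched⇔ s bc) t , bc∋b (proj₁ s)

  centre-unique : ∀ {z f g} → Mʳ f → Mʳ g → FromCentre z f → FromCentre z g → f ≡ g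
  centre-unique mf mg (kept _ p) (kept _ q) = kept-unique (unique tt mf (inj₁ p) mg (inj₁ q))
  centre-unique mf mg (kept (keep _ off) p) (spoke s q) with spoke-edge s mg q
  ... | k , m , cov = ⊥-elim (kept-off-kite off mf (inj₁ p) s k m cov)
  centre-unique mf mg (spoke s q) (kept (keep _ off) p) with spoke-edge s mf q
  ... | k , m , cov = ⊥-elim (kept-off-kite off mg (inj₁ p) s k m cov)
  centre-unique mf mg (spoke s p) (spoke t q) with spoke-edge s mf p | spoke-edge t mg q
  ... | k , m , cov | k′ , m′ , cov′ with kiteEdge-owner s t {k} {k′} (unique tt m cov m′ cov′)
  ... | refl = refl

  d-tail : ∀ s {k} → Mʳ (inj₂ (s , k)) → Touches k d′ → M (etail (proj₁ s))
  d-tail s m t = Equivalence.from (matched⇔ s tail) (selected-covered (selected m) t)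

  tailEnd-unique : ∀ {z f g} → Mʳ f → Mʳ g → IntoTailEnd z f → IntoTailEnd z g → f ≡ g
  tailEnd-unique mf mg (kept _ p) (kept _ q) = kept-unique (unique tt mf (inj₂ p) mg (inj₂ q))
  tailEnd-unique mf mg (kept (keep _ off) p) (fromD s t q) =
    ⊥-elim (kept-off-kite off mf (inj₂ p) s tail (d-tail s mg t) (inj₂ q))
  tailEnd-unique mf mg (fromD s t q) (kept (keep _ off) p) =
    ⊥-elim (kept-off-kite off mg (inj₂ p) s tail (d-tail s mf t) (inj₂ q))
  tailEnd-unique mf mg (fromD s t p) (fromD s′ t′ q)
    with kiteEdge-owner s s′ {tail} {tail} (unique tt (d-tail s mf t) (inj₂ p) (d-tail s′ mg t′) (inj₂ q))
  ... | refl = same-square-unique s mf mg t t′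

  selected-free : ∀ s R {k} → Mʳ (inj₂ (s , k)) → Touches k (corner R) → SlotFree s R
  selected-free s rA m t with selected-covered (selected m) t
  ... | ¬ab , ¬ad = ¬ab ∘ Equivalence.to (matched⇔ s ab) , ¬ad ∘ Equivalence.to (matched⇔ s ad)
  selected-free s rC m t with selected-covered (selected m) t
  ... | ¬bc , ¬dc = ¬bc ∘ Equivalence.to (matched⇔ s bc) , ¬dc ∘ Equivalence.to (matched⇔ s dc)

  free-unmatched : ∀ {u R w} → SlotFree u R → SlotEdge u R w → ¬ M w
  free-unmatched (¬long , _) (inj₁ refl) = ¬long
  free-unmatched (_ , ¬short) (inj₂ refl) = ¬short

  partners-not-both-free : ∀ s R → SlotFree s R → SlotFree (partnerSquare s R) R → ⊥
  partners-not-both-free s R free free′ with slot-star s R (mate-covers (vertexOf R (proj₁ s)) tt)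
  ... | _ , inj₁ refl , e = free-unmatched {s} {R} free e (mate∈M (vertexOf R (proj₁ s)) tt)
  ... | _ , inj₂ refl , e = free-unmatched {partnerSquare s R} {R} free′ e (mate∈M (vertexOf R (proj₁ s)) tt)

  slot-unique : ∀ s R t R′ {k k′} → Mʳ (inj₂ (s , k)) → Mʳ (inj₂ (t , k′)) →
                Touches k (corner R) → Touches k′ (corner R′) → vertexOf R (proj₁ s) ≡ vertexOf R′ (proj₁ t) →
                _≡_ {A = E′ P} (inj₂ (s , k)) (inj₂ (t , k′))
  slot-unique s R t R′ mf mg tf tg eq with same-vertex-role s t R R′ eq
  ... | refl with same-vertex s t R eq
  ...   | inj₁ refl = same-square-unique s mf mg tf tg
  ...   | inj₂ refl = ⊥-elim (partners-not-both-free s R (selected-free s R mf tf) (selected-free t R mg tg))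

  meeting-unique : ∀ {c f g} → Mʳ f → Mʳ g → Meeting c f → Meeting c g → f ≡ g
  meeting-unique mf mg (atInner s t) (atInner _ t′)   = same-square-unique s mf mg t t′
  meeting-unique mf mg (atCentre _ p) (atCentre _ q)   = centre-unique mf mg p q
  meeting-unique mf mg (atTailEnd _ p) (atTailEnd _ q) = tailEnd-unique mf mg p q
  meeting-unique mf mg (atSlot s R t p) (atSlot s′ R′ t′ q) =
    slot-unique s R s′ R′ mf mg t t′ (inj₁-injective (trans (sym p) q))
  meeting-unique _ _ (atInner _ _) (atSlot _ _ _ ())
  meeting-unique _ _ (atSlot _ _ _ ()) (atInner _ _)
  meeting-unique _ _ (atCentre cz _) (atTailEnd te _) = ⊥-elim (centre-not-midpoint cz (tailEnd-midpoint te))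
  meeting-unique _ _ (atTailEnd te _) (atCentre cz _) = ⊥-elim (centre-not-midpoint cz (tailEnd-midpoint te))
  meeting-unique _ _ (atCentre cz _) (atSlot s R _ p) = ⊥-elim (centre-not-slot cz s R (inj₁-injective p))
  meeting-unique _ _ (atSlot s R _ p) (atCentre cz _) = ⊥-elim (centre-not-slot cz s R (inj₁-injective p))
  meeting-unique _ _ (atTailEnd te _) (atSlot s R _ p) = ⊥-elim (tailEnd-not-slot te s R (inj₁-injective p))
  meeting-unique _ _ (atSlot s R _ p) (atTailEnd te _) = ⊥-elim (tailEnd-not-slot te s R (inj₁-injective p))

  matched-unique : ∀ v f g → Mʳ f → Covers (G′ P) f v → Mʳ g → Covers (G′ P) g v → f ≡ g
  matched-unique v f g mf cf mg cg with covering-end cf | covering-end cg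
  ... | e , p | e′ , q = meeting-unique mf mg (subst (λ c → Meeting c f) p (meeting f e))
                                              (subst (λ c → Meeting c g) q (meeting g e′))

  perfect : IsPerfectMatching (G′ P) Mʳ
  perfect v uncontracted = every-vertex-covered v uncontracted , matched-unique v

mainTheorem2 : (P : OppPair) (M : EG → Set) → IsPerfectMatching dP3 M →
    (ch : PSq P → Choice P) → IsPerfectMatching (G′ P) (M′ P M ch)
mainTheorem2 P M pm ch = Renewal.perfect P pm ch
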